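{- For every $i\in\langle N\rangle$ and $u\in\langle N\rangle^*$ with $|u|\ge2$, the antipode of the left Lagrange Hopf algebra satisfies $$S_{\mathcal L}(Y_u^i)=\sum_{T\in\mathbf{RT}_u^i}(-1)^{\mathbf v(T)}\Lambda_{\downarrow L}(T).$$
   Context: Fix $N\ge1$, let $\langle N\rangle=\{1,\ldots,N\}$ and $\langle N\rangle^*$ the free monoid of words over $\langle N\rangle$; for $u=u(1)\cdots u(p)$ write $|u|=p$ and for an interval $C\subseteq\{1,\ldots,p\}$ let $u|C$ be the subword $(u(k))_{k\in C}$. Let $\mathcal H=\mathcal H^N$ be the free unital associative algebra over $\mathbb C$ on symbols $Y_u^i$ ($i\in\langle N\rangle$, $|u|\ge2$), with the convention $Y_j^i=\delta_{ij}1$ for $i,j\in\langle N\rangle$. It is a bialgebra with multiplicative counit $\varepsilon(1)=1$, $\varepsilon(Y_u^i)=0$, and algebra-homomorphism coproduct given for $|u|=p$ by $\Delta(Y_u^i)=\sum_{q=1}^{p}\sum_{(C_1,\ldots,C_q)}\sum_{v\in\langle N\rangle^q}Y_{u|C_1}^{v(1)}\cdots Y_{u|C_q}^{v(q)}\otimes Y_v^i$, the middle sum over all partitions of $\{1,\ldots,p\}$ into $q$ nonempty consecutive intervals $C_1<\cdots<C_q$. It is graded (by $|u|-1$) and connected, hence a Hopf algebra with antipode $S_{\mathcal H}$, which is invertible. The left Lagrange Hopf algebra is $\mathcal L=(\mathcal H,m,1,\Delta^{op},\varepsilon,S_{\mathcal L})$, $\Delta^{op}=\tau\circ\Delta$ ($\tau$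 the flip), with antipode $S_{\mathcal L}=S_{\mathcal H}^{ -1}$. Trees: a planar rooted tree is a finite rooted tree with the children of each vertex linearly ordered left to right; leaves (vertices without children) are read left to right in the induced planar order. An $N$-coloring assigns each vertex $x$ a color $c(x)\in\langle N\rangle$, such that if $x$ has exactly one child $y$ then $c(y)=c(x)$. A tree is reduced if no vertex has exactly one child. $\mathbf{RT}_u^i$ is the set of isomorphism classes of reduced $N$-colored planar trees whose root has color $i$ and whose leaves, read left to right, have colors $u(1),\ldots,u(|u|)$. For a non-leaf vertex $x$ with children colored $w(1),\ldots,w(k)$ left to right, $Y(x)=Y^{c(x)}_{w(1)\cdots w(k)}$. $\mathbf v(T)$ is the number of non-leaf vertices. For distinct vertices $x,y$ write $x\triangleleft_L y$ if either $y$ is an ancestor of $x$, or neither is an ancestor of the other and, with $z$ their nearest common ancestor, the child of $z$ on the path to $x$ lies to the left of the child of $z$ on the path to $y$. $\Lambda_{\downarrow L}(T)=Y(x_1)\cdots Y(x_r)$ where $x_1,\ldots,x_r$ are the non-leaf vertices listed with $x_{k+1}\triangleleft_L x_k$ for all $k$ (so $x_1$ is the root). -}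

module Defs where

open import Algebra.Bundles using (CommutativeRing)
open import Data.Nat using (ℕ; zero; suc; _≤_)
open import Data.Fin using (Fin) renaming (_≟_ to _≟F_)
open import Data.List.Base using (List; []; _∷_; _++_; map; concatMap; allFin; foldr; length; zipWith; reverse)
import Data.List.Properties as LP
open import Data.Product using (_×_; _,_)
import Data.Product.Properties as PP
open import Relation.Nullary using (yes; no; ¬_)
open import Relation.Binary.Definitions using (DecidableEquality)
open import Relation.Binary.PropositionalEquality using (_≡_)

-- The left Lagrange Hopf algebra with coefficients in a commutative ring R
-- (the paper uses R = ℂ), for a fixed number N of colours.
module Lagrange {c ℓ} (R : CommutativeRing c ℓ) (N : ℕ) where
  open CommutativeRing R renaming (Carrier to K)

  Color : Set
  Color = Fin N

  Word : Set
  Word = List Color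

  -- A generator Y^i_u with |u| ≥ 2 : the pair (i , (a , b , w)) stands for
  -- Y^i_{a b w}, so every generator has a word of length at least 2.
  Gen : Set
  Gen = Color × (Color × Color × Word)

  Mon : Set
  Mon = List Gen

  _≟M_ : DecidableEquality Mon
  _≟M_ = LP.≡-dec (PP.≡-dec _≟F_ (PP.≡-dec _≟F_ (PP.≡-dec _≟F_ (LP.≡-dec _≟F_))))

  Poly : Set c
  Poly = List (K × Mon)

  coeff : Poly → Mon → K
  coeff [] m = 0#
  coeff ((a , m′) ∷ p) m with m′ ≟M m
  ... | yes _ = a + coeff p m
  ... | no _ = coeff p m

  _≈P_ : Poly → Poly → Set ℓ
  p ≈P q = ∀ m → coeff p m ≈ coeff q m

  zeroP : Poly
  zeroP = []

  oneP : Poly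
  oneP = (1# , []) ∷ []

  _+P_ : Poly → Poly → Poly
  p +P q = p ++ q

  scale : K → Poly → Poly
  scale a p = map (λ { (b , m) → (a * b , m) }) p

  _*P_ : Poly → Poly → Poly
  p *P q = concatMap (λ { (a , m) → map (λ { (b , n) → (a * b , m ++ n) }) q }) p

  prodP : List Poly → Poly
  prodP = foldr _*P_ oneP

  sumP : List Poly → Poly
  sumP = foldr _+P_ zeroP

  -- Y^i_u, with the convention Y^i_j = δ_{ij} 1 (Y^i_[] is never used).
  Y : Color → Word → Poly
  Y i [] = zeroP
  Y i (j ∷ []) with i ≟F j
  ... | yes _ = oneP
  ... | no _ = zeroP
  Y i (a ∷ b ∷ w) = (1# , (i , (a , b , w)) ∷ []) ∷ []

  -- All decompositions of a word into nonempty consecutive blocks C₁ < ⋯ < C_q.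
  attach : Color → List Word → List (List Word)
  attach x [] = []
  attach x (b ∷ bs) = ((x ∷ b) ∷ bs) ∷ []

  splits : Word → List (List Word)
  splits [] = [] ∷ []
  splits (x ∷ xs) = concatMap (λ s → ((x ∷ []) ∷ s) ∷ attach x s) (splits xs)

  words : ℕ → List Word
  words zero = [] ∷ []
  words (suc q) = concatMap (λ j → map (j ∷_) (words q)) (allFin N)

  Tensor : Set c
  Tensor = List (Poly × Poly)

  _*T_ : Tensor → Tensor → Tensor
  s *T t = concatMap (λ { (a , b) → map (λ { (a′ , b′) → (a *P a′ , b *P b′) }) t }) s

  -- The coproduct Δ (of H, not yet flipped).
  ΔGen : Gen → Tensor
  ΔGen (i , (a , b , w)) =
    concatMap (λ Cs → map (λ v → (prodP (zipWith Y v Cs) , Y i v)) (words (length Cs)))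
              (splits (a ∷ b ∷ w))

  ΔMon : Mon → Tensor
  ΔMon m = foldr _*T_ ((oneP , oneP) ∷ []) (map ΔGen m)

  Δ : Poly → Tensor
  Δ p = concatMap (λ { (k , m) → map (λ { (a , b) → (scale k a , b) }) (ΔMon m) }) p

  -- Counit: multiplicative, zero on generators.
  ε : Poly → K
  ε p = coeff p []

  linExt : (Mon → Poly) → Poly → Poly
  linExt f p = sumP (map (λ { (k , m) → scale k (f m) }) p)

  -- S (given on the basis, extended linearly) is an antipode of
  -- L = (H, m, 1, Δ^op, ε):  m ∘ (S ⊗ id) ∘ Δ^op = η ∘ ε = m ∘ (id ⊗ S) ∘ Δ^op.
  -- Since Δ x = Σ a ⊗ b, Δ^op x = Σ b ⊗ a.
  IsAntipodeL : (Mon → Poly) → Set (c Agda.Primitive.⊔ ℓ)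
  IsAntipodeL S = ∀ (x : Poly) →
      (sumP (map (λ { (a , b) → linExt S b *P a }) (Δ x)) ≈P scale (ε x) oneP)
    × (sumP (map (λ { (a , b) → b *P linExt S a }) (Δ x)) ≈P scale (ε x) oneP)

  -- Planar rooted N-coloured trees (isomorphism classes = syntactic trees).
  data Tree : Set where
    node : Color → List Tree → Tree

  rootColor : Tree → Color
  rootColor (node x _) = x

  mutual
    leafColors : Tree → Word
    leafColors (node x []) = x ∷ []
    leafColors (node x (t ∷ ts)) = leafColorsL (t ∷ ts)

    leafColorsL : List Tree → Word
    leafColorsL [] = []
    leafColorsL (t ∷ ts) = leafColors t ++ leafColorsL ts

  mutual
    Reduced : Tree → Set
    Reduced (node x ts) = (¬ (length ts ≡ 1)) × ReducedL ts

    ReducedL : List Tree → Set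
    ReducedL [] = Data.Unit.⊤ where import Data.Unit
    ReducedL (t ∷ ts) = Reduced t × ReducedL ts

  InRT : Color → Word → Tree → Set
  InRT i u T = (rootColor T ≡ i) × (leafColors T ≡ u) × Reduced T

  -- Y(x) for the non-leaf vertices x, listed in postorder (children left to
  -- right, then the vertex).  Postorder is exactly the increasing order for ◁_L.
  mutual
    postY : Tree → List Poly
    postY (node x []) = []
    postY (node x (t ∷ ts)) = postYL (t ∷ ts) ++ (Y x (map rootColor (t ∷ ts)) ∷ [])

    postYL : List Tree → List Poly
    postYL [] = []
    postYL (t ∷ ts) = postY t ++ postYL ts

  vT : Tree → ℕ
  vT T = length (postY T)

  -- Λ_{↓L}(T) = Y(x₁)⋯Y(x_r) with x_{k+1} ◁_L x_k, i.e. reverse postorder.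
  ΛL : Tree → Poly
  ΛL T = prodP (reverse (postY T))

  sign : ℕ → K
  sign zero = 1#
  sign (suc n) = (- 1#) * sign n

module Submission where

open import Defs
open import Level using (Level; _⊔_)
open import Algebra.Bundles using (CommutativeMonoid; Semiring; Ring; CommutativeRing)
open import Data.Empty using (⊥; ⊥-elim)
open import Data.Unit using (⊤; tt)
open import Data.Nat using (ℕ; zero; suc; _≤_; _<_; _≤?_; z≤n; s≤s)
import Data.Nat as ℕ
import Data.Nat.Properties as ℕ
open import Data.Fin.Properties using () renaming (_≟_ to _≟F_)
open import Data.List.Base
  using ( List; []; _∷_; _++_; [_]; map; concat; concatMap; foldr; filter; length; reverse
        ; zip; zipWith; allFin; deduplicate)
import Data.List.Properties as List
open import Data.List.Membership.Propositional using (_∈_; find; lose)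
import Data.List.Membership.Propositional.Properties as ∈
open import Data.List.Membership.Propositional.Properties.WithK using (unique∧set⇒bag)
open import Data.List.Relation.Binary.BagAndSetEquality using (∼bag⇒↭)
open import Data.List.Relation.Binary.Permutation.Propositional as ↭ using (_↭_)
open import Data.List.Relation.Binary.Pointwise using (Pointwise; []; _∷_)
open import Data.List.Relation.Binary.Pointwise.Properties using (Pointwise-length)
open import Data.List.Relation.Unary.All as All using (All; []; _∷_)
import Data.List.Relation.Unary.All.Properties as All
open import Data.List.Relation.Unary.AllPairs using ([]; _∷_)
open import Data.List.Relation.Unary.Any using (here; there)
open import Data.List.Relation.Unary.Unique.Propositional using (Unique)
import Data.List.Relation.Unary.Unique.Propositional.Properties as Unique
import Data.List.Relation.Unary.Unique.DecPropositional.Properties as UniqueDec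
open import Data.Product using (∃; ∃₂; _×_; _,_; proj₁; proj₂; uncurry)
open import Data.Sum as Sum using (_⊎_; inj₁; inj₂; [_,_]′)
open import Function using (_∘_)
open import Function.Bundles using (_⇔_; mk⇔; Equivalence)
open import Relation.Nullary using (yes; no; ¬_)
open import Relation.Unary using (Pred; Decidable)
open import Relation.Binary.Definitions using (DecidableEquality)
open import Relation.Binary.Structures using (IsEquivalence)
import Relation.Binary.Reasoning.Setoid
open import Relation.Binary.PropositionalEquality as ≡ using (_≡_; _≢_)

-- For G assigning an element G i v of H to each generator, let (G ⋆Y) i u be the sum of
-- G i v · Y^{v(1)}_{u|C₁} ⋯ Y^{v(q)}_{u|C_q} over all coloured splittings (C, v) of u. The first
-- antipode axiom of L says exactly that G i v = S_L(Y^i_v) satisfies G ⋆Y = δ, where δ i u is 1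
-- if u is the one-letter word i and 0 otherwise. This equation determines G on nonempty words by
-- induction on their length: a splitting with as many blocks as u has letters contributes only
-- if it is the splitting into letters, and then it contributes G i u itself.
--
-- It therefore suffices to show that the signed tree sums F i u = Σ_{T ∈ RT^i_u} (-1)^{v(T)} Λ_{↓L}(T)
-- also satisfy F ⋆Y = δ. Removing the root gives F i u = δ i u − Σ_Q Y^i_{colours Q} · Π_B F(B)
-- over splittings Q of u into at least two blocks B, the product running from the last block to
-- the first as Λ_{↓L} prescribes. Substituting this into F ⋆Y and regrouping a splitting of u
-- followed by a coarser splitting of its colour word as a splitting Q followed by splittings of the
-- blocks of Q, the inner sums become F ⋆Y on the blocks, which is δ by induction; then only the
-- splitting of u into letters survives, and it cancels Y^i_u.
--
-- Elements of H are compared by evaluating them against every function on monomials, which is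
-- equivalent to comparing coefficients and makes the formal sums a ring.

private variable
  a b p q : Level
  A B I : Set a

pairs : List A → (A → List B) → List (A × B)
pairs xs ys = concatMap (λ x → map (x ,_) (ys x)) xs

choices : List (List A) → List (List A)
choices []         = [] ∷ []
choices (xs ∷ xss) = map (uncurry _∷_) (pairs xs (λ _ → choices xss))

module Enumeration where

  record Enumerates {A : Set a} (P : Pred A p) (xs : List A) : Set (a ⊔ p) where
    field
      unique : Unique xs
      sound : ∀ {x} → x ∈ xs → P x
      complete : ∀ {x} → P x → x ∈ xs

  open Enumerates public

  Enumerates⇒↭ : ∀ {P : Pred A p} {xs ys} → Enumerates P xs → Enumerates P ys → xs ↭ ys
  Enumerates⇒↭ E E′ = ∼bag⇒↭ (unique∧set⇒bag (unique E) (unique E′)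
    (mk⇔ (complete E′ ∘ sound E) (complete E ∘ sound E′)))

  Enumerates-resp : ∀ {P : Pred A p} {Q : Pred A q} {xs} →
                    (∀ {x} → P x → Q x) → (∀ {x} → Q x → P x) →
                    Enumerates P xs → Enumerates Q xs
  Enumerates-resp P⇒Q Q⇒P E = record
    { unique = unique E ; sound = P⇒Q ∘ sound E ; complete = complete E ∘ Q⇒P }

  ∈-concatMap⁻ : ∀ (f : A → List B) xs {y} → y ∈ concatMap f xs → ∃ λ x → x ∈ xs × y ∈ f x
  ∈-concatMap⁻ f xs = find ∘ ∈.∈-concatMap⁻ f {xs = xs}

  ∈-concatMap⁺ : ∀ (f : A → List B) {xs x y} → x ∈ xs → y ∈ f x → y ∈ concatMap f xs
  ∈-concatMap⁺ f x∈ y∈ = ∈.∈-concatMap⁺ f (lose x∈ y∈)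

  concatMap⁺ : ∀ {P : Pred A p} {f : A → List B} {xs} → Enumerates P xs →
               (∀ {x} → P x → Unique (f x)) →
               (∀ {x x′ y} → P x → P x′ → y ∈ f x → y ∈ f x′ → x ≡ x′) →
               Enumerates (λ y → ∃ λ x → P x × y ∈ f x) (concatMap f xs)
  concatMap⁺ {P = P} {f} {xs} E unique-f disjoint = record
    { unique = unique-concatMap (unique E) (sound E)
    ; sound = λ y∈ → let x , x∈ , y∈fx = ∈-concatMap⁻ f xs y∈ in x , sound E x∈ , y∈fx
    ; complete = λ (x , Px , y∈fx) → ∈-concatMap⁺ f (complete E Px) y∈fx
    }
    where
    unique-concatMap : ∀ {ys} → Unique ys → (∀ {x} → x ∈ ys → P x) → Unique (concatMap f ys)
    unique-concatMap {[]}     _          _    = []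
    unique-concatMap {x ∷ ys} (x∉ys ∷ u) ys⊆P =
      Unique.++⁺ (unique-f (ys⊆P (here ≡.refl))) (unique-concatMap u (ys⊆P ∘ there)) apart
      where
      apart : ∀ {y} → ¬ (y ∈ f x × y ∈ concatMap f ys)
      apart (y∈fx , y∈rest) with x′ , x′∈ , y∈fx′ ← ∈-concatMap⁻ f ys y∈rest =
        All.lookup x∉ys x′∈ (disjoint (ys⊆P (here ≡.refl)) (ys⊆P (there x′∈)) y∈fx y∈fx′)

  ++⁺ : ∀ {P : Pred A p} {Q : Pred A q} {xs ys} → Enumerates P xs → Enumerates Q ys →
        (∀ {x} → P x → Q x → ⊥) → Enumerates (λ x → P x ⊎ Q x) (xs ++ ys)
  ++⁺ {xs = xs} E E′ apart = record
    { unique = Unique.++⁺ (unique E) (unique E′) (λ (x∈ , x∈′) → apart (sound E x∈) (sound E′ x∈′))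
    ; sound = Sum.map (sound E) (sound E′) ∘ ∈.∈-++⁻ xs
    ; complete = Sum.[ ∈.∈-++⁺ˡ ∘ complete E , ∈.∈-++⁺ʳ xs ∘ complete E′ ]
    }

  filter⁺ : ∀ {P : Pred A p} {Q : Pred A q} (Q? : Decidable Q) {xs} → Enumerates P xs →
            Enumerates (λ x → P x × Q x) (filter Q? xs)
  filter⁺ Q? E = record
    { unique = Unique.filter⁺ Q? (unique E)
    ; sound = λ x∈ → let x∈xs , Qx = ∈.∈-filter⁻ Q? x∈ in sound E x∈xs , Qx
    ; complete = λ (Px , Qx) → ∈.∈-filter⁺ Q? (complete E Px) Qx
    }

  map⁺ : ∀ {P : Pred A p} (f : A → B) {xs} → Enumerates P xs →
         (∀ {x y} → P x → P y → f x ≡ f y → x ≡ y) →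
         Enumerates (λ z → ∃ λ x → P x × f x ≡ z) (map f xs)
  map⁺ {P = P} f {xs} E injective = record
    { unique = unique-map (unique E) (sound E)
    ; sound = λ z∈ → let x , x∈ , z≡fx = ∈.∈-map⁻ f z∈ in x , sound E x∈ , ≡.sym z≡fx
    ; complete = λ { (x , Px , ≡.refl) → ∈.∈-map⁺ f (complete E Px) }
    }
    where
    unique-map : ∀ {ys} → Unique ys → (∀ {x} → x ∈ ys → P x) → Unique (map f ys)
    unique-map {[]}     _          _    = []
    unique-map {x ∷ ys} (x∉ys ∷ u) ys⊆P = All.tabulate fx∉ ∷ unique-map u (ys⊆P ∘ there)
      where
      fx∉ : ∀ {z} → z ∈ map f ys → f x ≢ z
      fx∉ z∈ fx≡z with y , y∈ , ≡.refl ← ∈.∈-map⁻ f z∈ =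
        All.lookup x∉ys y∈ (injective (ys⊆P (here ≡.refl)) (ys⊆P (there y∈)) fx≡z)

  pairs⁺ : ∀ {P : Pred A p} {Q : A → Pred B q} {xs ys} → Enumerates P xs →
           (∀ {x} → P x → Enumerates (Q x) (ys x)) →
           Enumerates (λ (x , y) → P x × Q x y) (pairs xs ys)
  pairs⁺ {P = P} {Q} {xs} {ys} E E′ = Enumerates-resp sound′ complete′
    (concatMap⁺ E (λ Px → Unique.map⁺ (≡.cong proj₂) (unique (E′ Px))) sameFirst)
    where
    sameFirst : ∀ {x x′ z} → P x → P x′ → z ∈ map (x ,_) (ys x) → z ∈ map (x′ ,_) (ys x′) → x ≡ x′
    sameFirst _ _ z∈ z∈′ with _ , _ , ≡.refl ← ∈.∈-map⁻ _ z∈ | _ , _ , ≡.refl ← ∈.∈-map⁻ _ z∈′ = ≡.refl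
    sound′ : ∀ {z} → (∃ λ x → P x × z ∈ map (x ,_) (ys x)) → P (proj₁ z) × Q (proj₁ z) (proj₂ z)
    sound′ (x , Px , z∈) with y , y∈ , ≡.refl ← ∈.∈-map⁻ _ z∈ = Px , sound (E′ Px) y∈
    complete′ : ∀ {z} → P (proj₁ z) × Q (proj₁ z) (proj₂ z) → ∃ λ x → P x × z ∈ map (x ,_) (ys x)
    complete′ (Px , Qxy) = _ , Px , ∈.∈-map⁺ _ (complete (E′ Px) Qxy)

  choices⁺ : ∀ {P : I → Pred A p} (en : I → List A) is →
             (∀ {i} → i ∈ is → Enumerates (P i) (en i)) →
             Enumerates (Pointwise P is) (choices (map en is))
  choices⁺ en []       _ = record
    { unique = All.[] ∷ [] ; sound = λ { (here ≡.refl) → [] } ; complete = λ { [] → here ≡.refl } }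
  choices⁺ {P = P} en (i ∷ is) E = Enumerates-resp sound′ complete′
    (map⁺ (uncurry _∷_) (pairs⁺ (E (here ≡.refl)) (λ _ → choices⁺ en is (E ∘ there)))
          (λ { _ _ ≡.refl → ≡.refl }))
    where
    sound′ : ∀ {zs} → (∃ λ (x , xs) → (P i x × Pointwise P is xs) × x ∷ xs ≡ zs) →
             Pointwise P (i ∷ is) zs
    sound′ (_ , (p , ps) , ≡.refl) = p ∷ ps
    complete′ : ∀ {zs} → Pointwise P (i ∷ is) zs →
                ∃ λ (x , xs) → (P i x × Pointwise P is xs) × x ∷ xs ≡ zs
    complete′ (p ∷ ps) = _ , (p , ps) , ≡.refl

module ListSum {c ℓ} (M : CommutativeMonoid c ℓ) where
  open CommutativeMonoid M renaming (Carrier to C)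
  open import Algebra.Properties.CommutativeSemigroup commutativeSemigroup using (interchange)
  open import Relation.Binary.Reasoning.Setoid setoid

  ∑ : (A → C) → List A → C
  ∑ f xs = foldr _∙_ ε (map f xs)

  ∑-cong : ∀ {f g : A → C} xs → (∀ {x} → x ∈ xs → f x ≈ g x) → ∑ f xs ≈ ∑ g xs
  ∑-cong []       f≈g = refl
  ∑-cong (x ∷ xs) f≈g = ∙-cong (f≈g (here ≡.refl)) (∑-cong xs (f≈g ∘ there))

  ∑-ε : ∀ {f : A → C} xs → (∀ {x} → x ∈ xs → f x ≈ ε) → ∑ f xs ≈ ε
  ∑-ε []       f≈ε = refl
  ∑-ε (x ∷ xs) f≈ε = trans (∙-cong (f≈ε (here ≡.refl)) (∑-ε xs (f≈ε ∘ there))) (identityˡ ε)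

  ∑-++ : ∀ (f : A → C) xs ys → ∑ f (xs ++ ys) ≈ ∑ f xs ∙ ∑ f ys
  ∑-++ f []       ys = sym (identityˡ _)
  ∑-++ f (x ∷ xs) ys = trans (∙-congˡ (∑-++ f xs ys)) (sym (assoc _ _ _))

  ∑-map : ∀ (f : B → C) (g : A → B) xs → ∑ f (map g xs) ≡ ∑ (f ∘ g) xs
  ∑-map f g xs = ≡.cong (foldr _∙_ ε) (≡.sym (List.map-∘ xs))

  ∑-concatMap : ∀ (f : B → C) (g : A → List B) xs →
                ∑ f (concatMap g xs) ≈ ∑ (λ x → ∑ f (g x)) xs
  ∑-concatMap f g []       = refl
  ∑-concatMap f g (x ∷ xs) = trans (∑-++ f (g x) (concatMap g xs)) (∙-congˡ (∑-concatMap f g xs))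

  ∑-∙ : ∀ (f g : A → C) xs → ∑ (λ x → f x ∙ g x) xs ≈ ∑ f xs ∙ ∑ g xs
  ∑-∙ f g []       = sym (identityˡ ε)
  ∑-∙ f g (x ∷ xs) = trans (∙-congˡ (∑-∙ f g xs)) (interchange _ _ _ _)

  ∑-swap : ∀ (f : A → B → C) xs ys →
           ∑ (λ x → ∑ (f x) ys) xs ≈ ∑ (λ y → ∑ (λ x → f x y) xs) ys
  ∑-swap f []       ys = sym (∑-ε ys (λ _ → refl))
  ∑-swap f (x ∷ xs) ys = trans (∙-congˡ (∑-swap f xs ys)) (sym (∑-∙ (f x) _ ys))

  ∑-pairs : ∀ (f : A × B → C) xs (ys : A → List B) →
            ∑ f (pairs xs ys) ≈ ∑ (λ x → ∑ (λ y → f (x , y)) (ys x)) xs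
  ∑-pairs f xs ys = trans (∑-concatMap f _ xs) (∑-cong xs (λ {x} _ → reflexive (∑-map f (x ,_) (ys x))))

  ∑-↭ : ∀ (f : A → C) {xs ys} → xs ↭ ys → ∑ f xs ≈ ∑ f ys
  ∑-↭ f ↭.refl          = refl
  ∑-↭ f (↭.prep x p)    = ∙-congˡ (∑-↭ f p)
  ∑-↭ f (↭.swap x y p)  = begin
    f x ∙ (f y ∙ _) ≈⟨ assoc _ _ _ ⟨
    (f x ∙ f y) ∙ _ ≈⟨ ∙-cong (comm _ _) (∑-↭ f p) ⟩
    (f y ∙ f x) ∙ _ ≈⟨ assoc _ _ _ ⟩
    f y ∙ (f x ∙ _) ∎
  ∑-↭ f (↭.trans p q)   = trans (∑-↭ f p) (∑-↭ f q)

  ∑-single : ∀ {f : A → C} {xs x} → Unique xs → x ∈ xs →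
             (∀ {y} → y ∈ xs → y ≢ x → f y ≈ ε) → ∑ f xs ≈ f x
  ∑-single {xs = y ∷ ys} (y∉ys ∷ _) (here ≡.refl) others =
    trans (∙-congˡ (∑-ε ys (λ z∈ → others (there z∈) λ z≡y → All.lookup y∉ys z∈ (≡.sym z≡y))))
          (identityʳ _)
  ∑-single {xs = y ∷ ys} (y∉ys ∷ u) (there x∈) others =
    trans (∙-cong (others (here ≡.refl) λ y≡x → All.lookup y∉ys x∈ y≡x)
                  (∑-single u x∈ (others ∘ there)))
          (identityˡ _)

module ListSumDistrib {c ℓ} (S : Semiring c ℓ) where
  open Semiring S renaming (Carrier to C)
  open ListSum +-commutativeMonoid
  open import Relation.Binary.Reasoning.Setoid setoid

  ∑-distribˡ : ∀ k (f : A → C) xs → k * ∑ f xs ≈ ∑ (λ x → k * f x) xs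
  ∑-distribˡ k f []       = zeroʳ k
  ∑-distribˡ k f (x ∷ xs) = trans (distribˡ k _ _) (+-congˡ (∑-distribˡ k f xs))

  ∑-distribʳ : ∀ k (f : A → C) xs → ∑ f xs * k ≈ ∑ (λ x → f x * k) xs
  ∑-distribʳ k f []       = zeroˡ k
  ∑-distribʳ k f (x ∷ xs) = trans (distribʳ k _ _) (+-congˡ (∑-distribʳ k f xs))

  ∑-sandwich : ∀ k k′ (f : A → C) xs → ∑ (λ x → k * (f x * k′)) xs ≈ k * (∑ f xs * k′)
  ∑-sandwich k k′ f xs = sym (trans (*-congˡ (∑-distribʳ k′ f xs)) (∑-distribˡ k _ xs))

  ∏ʳ : List C → C
  ∏ʳ []       = 1#
  ∏ʳ (x ∷ xs) = ∏ʳ xs * x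

  ∏ʳ-cong : ∀ {f g : A → C} xs → (∀ {x} → x ∈ xs → f x ≈ g x) → ∏ʳ (map f xs) ≈ ∏ʳ (map g xs)
  ∏ʳ-cong []       f≈g = refl
  ∏ʳ-cong (x ∷ xs) f≈g = *-cong (∏ʳ-cong xs (f≈g ∘ there)) (f≈g (here ≡.refl))

  ∏ʳ-++ : ∀ xs ys → ∏ʳ (xs ++ ys) ≈ ∏ʳ ys * ∏ʳ xs
  ∏ʳ-++ []       ys = sym (*-identityʳ _)
  ∏ʳ-++ (x ∷ xs) ys = trans (*-congʳ (∏ʳ-++ xs ys)) (*-assoc _ _ x)

  ∑-choices : ∀ (f : A → C) xss → ∑ (λ xs → ∏ʳ (map f xs)) (choices xss) ≈ ∏ʳ (map (∑ f) xss)
  ∑-choices f []         = +-identityʳ 1#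
  ∑-choices f (xs ∷ xss) = begin
    ∑ (λ ys → ∏ʳ (map f ys)) (map (uncurry _∷_) (pairs xs λ _ → choices xss))
      ≡⟨ ∑-map _ (uncurry _∷_) (pairs xs λ _ → choices xss) ⟩
    ∑ (λ (x , ys) → ∏ʳ (map f ys) * f x) (pairs xs λ _ → choices xss)
      ≈⟨ ∑-pairs _ xs _ ⟩
    ∑ (λ x → ∑ (λ ys → ∏ʳ (map f ys) * f x) (choices xss)) xs
      ≈⟨ ∑-cong xs (λ {x} _ → sym (∑-distribʳ (f x) _ (choices xss))) ⟩
    ∑ (λ x → ∑ (λ ys → ∏ʳ (map f ys)) (choices xss) * f x) xs
      ≈⟨ ∑-cong xs (λ _ → *-congʳ (∑-choices f xss)) ⟩
    ∑ (λ x → ∏ʳ (map (∑ f) xss) * f x) xs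
      ≈⟨ ∑-distribˡ _ f xs ⟨
    ∏ʳ (map (∑ f) xss) * ∑ f xs
      ∎

NonEmpty : List A → Set
NonEmpty []      = ⊥
NonEmpty (_ ∷ _) = ⊤

map-proj₁-zip : ∀ (xs : List A) (ys : List B) → length xs ≡ length ys → map proj₁ (zip xs ys) ≡ xs
map-proj₁-zip []       []       _         = ≡.refl
map-proj₁-zip (x ∷ xs) (y ∷ ys) |xs|≡|ys| = ≡.cong (x ∷_) (map-proj₁-zip xs ys (ℕ.suc-injective |xs|≡|ys|))

map-proj₂-zip : ∀ (xs : List A) (ys : List B) → length xs ≡ length ys → map proj₂ (zip xs ys) ≡ ys
map-proj₂-zip []       []       _         = ≡.refl
map-proj₂-zip (x ∷ xs) (y ∷ ys) |xs|≡|ys| = ≡.cong (y ∷_) (map-proj₂-zip xs ys (ℕ.suc-injective |xs|≡|ys|))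

zip-map-proj : ∀ (xys : List (A × B)) → zip (map proj₁ xys) (map proj₂ xys) ≡ xys
zip-map-proj []         = ≡.refl
zip-map-proj (xy ∷ xys) = ≡.cong (xy ∷_) (zip-map-proj xys)

map-uncurry-zip : ∀ {c} {C : Set c} (f : A → B → C) xs ys →
                  map (uncurry f) (zip xs ys) ≡ zipWith f xs ys
map-uncurry-zip f []       _        = ≡.refl
map-uncurry-zip f (_ ∷ _)  []       = ≡.refl
map-uncurry-zip f (x ∷ xs) (y ∷ ys) = ≡.cong (f x y ∷_) (map-uncurry-zip f xs ys)

length-≤-concat : ∀ {xs : List A} xss → xs ∈ xss → length xs ≤ length (concat xss)
length-≤-concat (xs ∷ xss) (here ≡.refl) = List.length-++-≤ˡ xs
length-≤-concat (ys ∷ xss) (there xs∈) =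
  ℕ.≤-trans (length-≤-concat xss xs∈) (List.length-++-≤ʳ (concat xss) {ys})

length-concat-nonEmpty : ∀ (xss : List (List A)) → All NonEmpty xss → length xss ≤ length (concat xss)
length-concat-nonEmpty []                _        = z≤n
length-concat-nonEmpty ((x ∷ xs) ∷ xss) (_ ∷ ne) =
  s≤s (ℕ.≤-trans (length-concat-nonEmpty xss ne) (List.length-++-≤ʳ (concat xss) {xs}))

length-<-concat : ∀ {xs : List A} xss → All NonEmpty xss → 2 ≤ length xss → xs ∈ xss →
                  length xs < length (concat xss)
length-<-concat (xs ∷ (y ∷ ys) ∷ xss) _ _ (here ≡.refl) =
  ≡.subst (length xs <_) (≡.sym (List.length-++ xs)) (ℕ.m<m+n (length xs) (s≤s z≤n))
length-<-concat (xs ∷ [] ∷ xss)       (_ ∷ () ∷ _) _ (here ≡.refl)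
length-<-concat (xs ∷ [])             _ (s≤s ()) (here ≡.refl)
length-<-concat ((y ∷ ys) ∷ xss)      _ _ (there xs∈) =
  s≤s (ℕ.≤-trans (length-≤-concat xss xs∈) (List.length-++-≤ʳ (concat xss) {ys}))
length-<-concat ([] ∷ xss)            (() ∷ _) _ (there _)

all-singletons : ∀ (xss : List (List A)) → All NonEmpty xss → length (concat xss) ≤ length xss →
                 All (λ xs → length xs ≡ 1) xss
all-singletons []               _        _         = []
all-singletons ((x ∷ xs) ∷ xss) (_ ∷ ne) |c|≤|xss| = ≡.cong suc xs-empty ∷ all-singletons xss ne rest
  where
  bound : length (xs ++ concat xss) ≤ length xss
  bound = ℕ.≤-pred |c|≤|xss|
  rest : length (concat xss) ≤ length xss
  rest = ℕ.≤-trans (List.length-++-≤ʳ (concat xss) {xs}) bound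
  xs-empty : length xs ≡ 0
  xs-empty = ℕ.n≤0⇒n≡0 (ℕ.+-cancelʳ-≤ (length (concat xss)) (length xs) 0
    (≡.subst (_≤ length (concat xss)) (List.length-++ xs) (ℕ.≤-trans bound (length-concat-nonEmpty xss ne))))

++-injective : ∀ (xs ys : List A) {zs ws} → length xs ≡ length ys → xs ++ zs ≡ ys ++ ws →
               xs ≡ ys × zs ≡ ws
++-injective []       []       _         eq = ≡.refl , eq
++-injective (x ∷ xs) (y ∷ ys) |xs|≡|ys| eq
  with ≡.refl , eq′ ← List.∷-injective eq
  with xs≡ys , zs≡ws ← ++-injective xs ys (ℕ.suc-injective |xs|≡|ys|) eq′ = ≡.cong (x ∷_) xs≡ys , zs≡ws

map-≡⇒length-≡ : ∀ (f : A → B) xs ys → map f xs ≡ map f ys → length xs ≡ length ys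
map-≡⇒length-≡ f xs ys fxs≡fys =
  ≡.trans (≡.sym (List.length-map f xs)) (≡.trans (≡.cong length fxs≡fys) (List.length-map f ys))

concat-injective : ∀ {f : A → B} (xss yss : List (List A)) →
                   map (map f) xss ≡ map (map f) yss → concat xss ≡ concat yss → xss ≡ yss
concat-injective []         []         _     _  = ≡.refl
concat-injective {f = f} (xs ∷ xss) (ys ∷ yss) fxss≡ eq
  with fxs≡ , fxss≡′ ← List.∷-injective fxss≡
  with xs≡ys , rest≡ ← ++-injective xs ys (map-≡⇒length-≡ f xs ys fxs≡) eq =
  ≡.cong₂ _∷_ xs≡ys (concat-injective xss yss fxss≡′ rest≡)

unappend : ∀ (f : A → B) ys {zs} xs → map f xs ≡ ys ++ zs →
           ∃₂ λ xs₁ xs₂ → xs ≡ xs₁ ++ xs₂ × map f xs₁ ≡ ys × map f xs₂ ≡ zs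
unappend f []       xs       eq = [] , xs , ≡.refl , ≡.refl , eq
unappend f (y ∷ ys) (x ∷ xs) eq
  with fx≡y , eq′ ← List.∷-injective eq
  with xs₁ , xs₂ , ≡.refl , fxs₁≡ , fxs₂≡ ← unappend f ys xs eq′ =
  x ∷ xs₁ , xs₂ , ≡.refl , ≡.cong₂ _∷_ fx≡y fxs₁≡ , fxs₂≡

unconcat : ∀ (f : A → B) yss xs → map f xs ≡ concat yss →
           ∃ λ xss → concat xss ≡ xs × map (map f) xss ≡ yss
unconcat f []         []  _  = [] , ≡.refl , ≡.refl
unconcat f (ys ∷ yss) xs eq
  with xs₁ , xs₂ , ≡.refl , fxs₁≡ , fxs₂≡ ← unappend f ys xs eq
  with xss , ≡.refl , fxss≡ ← unconcat f yss xs₂ fxs₂≡ =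
  xs₁ ∷ xss , ≡.refl , ≡.cong₂ _∷_ fxs₁≡ fxss≡

module FreeAlgebra {c ℓ} (R : CommutativeRing c ℓ) (N : ℕ) where
  open Lagrange R N
  open CommutativeRing R renaming (Carrier to K)
  open import Algebra.Properties.Ring ring using (-1*x≈-x)
  module ∑K = ListSum +-commutativeMonoid
  module ∑K-distrib = ListSumDistrib semiring
  open import Relation.Binary.Reasoning.Setoid setoid

  eval : (Mon → K) → Poly → K
  eval h = ∑K.∑ (λ (a , m) → a * h m)

  infix 4 _≃_
  record _≃_ (p q : Poly) : Set (c ⊔ ℓ) where
    constructor mk≃
    field eval-≈ : ∀ h → eval h p ≈ eval h q
  open _≃_ public

  eval-congʳ : ∀ {h h′} → (∀ m → h m ≈ h′ m) → ∀ p → eval h p ≈ eval h′ p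
  eval-congʳ h≈h′ p = ∑K.∑-cong p (λ {(a , m)} _ → *-congˡ (h≈h′ m))

  eval-++ : ∀ h p q → eval h (p ++ q) ≈ eval h p + eval h q
  eval-++ h = ∑K.∑-++ _

  eval-shift : ∀ h a m q →
               eval h (map (λ (b , n) → a * b , m ++ n) q) ≈ a * eval (λ n → h (m ++ n)) q
  eval-shift h a m q = begin
    eval h (map (λ (b , n) → a * b , m ++ n) q)     ≡⟨ ∑K.∑-map _ _ q ⟩
    ∑K.∑ (λ (b , n) → a * b * h (m ++ n)) q         ≈⟨ ∑K.∑-cong q (λ _ → *-assoc _ _ _) ⟩
    ∑K.∑ (λ (b , n) → a * (b * h (m ++ n))) q       ≈⟨ ∑K-distrib.∑-distribˡ a _ q ⟨
    a * eval (λ n → h (m ++ n)) q                   ∎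

  eval-scale : ∀ h k p → eval h (scale k p) ≈ k * eval h p
  eval-scale h k = eval-shift h k []

  eval-*ʰ : ∀ k {h} p → eval (λ m → k * h m) p ≈ k * eval h p
  eval-*ʰ k {h} p = begin
    ∑K.∑ (λ (a , m) → a * (k * h m)) p ≈⟨ ∑K.∑-cong p (λ _ → x∙yz≈y∙xz _ k _) ⟩
    ∑K.∑ (λ (a , m) → k * (a * h m)) p ≈⟨ ∑K-distrib.∑-distribˡ k _ p ⟨
    k * eval h p                       ∎
    where open import Algebra.Properties.CommutativeSemigroup *-commutativeSemigroup using (x∙yz≈y∙xz)

  eval-+ʰ : ∀ {g g′} p → eval (λ m → g m + g′ m) p ≈ eval g p + eval g′ p
  eval-+ʰ {g} {g′} p = begin
    eval (λ m → g m + g′ m) p                        ≈⟨ ∑K.∑-cong p (λ _ → distribˡ _ _ _) ⟩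
    ∑K.∑ (λ (a , m) → a * g m + a * g′ m) p          ≈⟨ ∑K.∑-∙ _ _ p ⟩
    eval g p + eval g′ p                             ∎

  eval-0ʰ : ∀ {h} → (∀ m → h m ≈ 0#) → ∀ p → eval h p ≈ 0#
  eval-0ʰ h≈0 p = ∑K.∑-ε p (λ {(a , m)} _ → trans (*-congˡ (h≈0 m)) (zeroʳ a))

  eval-* : ∀ h p q → eval h (p *P q) ≈ eval (λ m → eval (λ n → h (m ++ n)) q) p
  eval-* h p q = trans (∑K.∑-concatMap _ _ p) (∑K.∑-cong p (λ {(a , m)} _ → eval-shift h a m q))

  eval-oneP : ∀ h → eval h oneP ≈ h []
  eval-oneP h = trans (+-identityʳ _) (*-identityˡ _)

  eval-sumP : ∀ h (f : A → Poly) xs → eval h (sumP (map f xs)) ≈ ∑K.∑ (eval h ∘ f) xs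
  eval-sumP h f []       = refl
  eval-sumP h f (x ∷ xs) = trans (eval-++ h (f x) _) (+-congˡ (eval-sumP h f xs))

  eval-linExt : ∀ (f : Mon → Poly) h p → eval h (linExt f p) ≈ eval (λ m → eval h (f m)) p
  eval-linExt f h p = trans (eval-sumP h _ p) (∑K.∑-cong p (λ {(k , m)} _ → eval-scale h k (f m)))

  indicator : Mon → Mon → K
  indicator m m′ with m′ ≟M m
  ... | yes _ = 1#
  ... | no  _ = 0#

  indicator-refl : ∀ m → indicator m m ≈ 1#
  indicator-refl m with m ≟M m
  ... | yes _   = refl
  ... | no  m≢m = ⊥-elim (m≢m ≡.refl)

  indicator-≢ : ∀ {m m′} → m′ ≢ m → indicator m m′ ≈ 0#
  indicator-≢ {m} {m′} m′≢m with m′ ≟M m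
  ... | yes m′≡m = ⊥-elim (m′≢m m′≡m)
  ... | no  _    = refl

  coeff≈eval-indicator : ∀ p m → coeff p m ≈ eval (indicator m) p
  coeff≈eval-indicator []             m = refl
  coeff≈eval-indicator ((a , m′) ∷ p) m with m′ ≟M m
  ... | yes _ = +-cong (sym (*-identityʳ a)) (coeff≈eval-indicator p m)
  ... | no  _ = trans (coeff≈eval-indicator p m) (sym (trans (+-congʳ (zeroʳ a)) (+-identityˡ _)))

  eval-∑ʰ : ∀ (g : A → Mon → K) xs p →
            eval (λ m → ∑K.∑ (λ x → g x m) xs) p ≈ ∑K.∑ (λ x → eval (g x) p) xs
  eval-∑ʰ g []       p = eval-0ʰ (λ _ → refl) p
  eval-∑ʰ g (x ∷ xs) p = trans (eval-+ʰ p) (+-congˡ (eval-∑ʰ g xs p))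

  -- On the support of p, h agrees with m′ ↦ Σ_{m ∈ M} h m · [m = m′].
  eval≈∑coeff : ∀ h p {M} → Unique M → (∀ {a m} → (a , m) ∈ p → m ∈ M) →
                eval h p ≈ ∑K.∑ (λ m → h m * coeff p m) M
  eval≈∑coeff h p {M} unique-M supp⊆M = begin
    eval h p
      ≈⟨ ∑K.∑-cong p (λ m∈ → *-congˡ (sym (pick m∈))) ⟩
    eval (λ m′ → ∑K.∑ (λ m → h m * indicator m m′) M) p
      ≈⟨ eval-∑ʰ _ M p ⟩
    ∑K.∑ (λ m → eval (λ m′ → h m * indicator m m′) p) M
      ≈⟨ ∑K.∑-cong M (λ {m} _ → eval-*ʰ (h m) p) ⟩
    ∑K.∑ (λ m → h m * eval (indicator m) p) M
      ≈⟨ ∑K.∑-cong M (λ {m} _ → *-congˡ (sym (coeff≈eval-indicator p m))) ⟩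
    ∑K.∑ (λ m → h m * coeff p m) M
      ∎
    where
    pick : ∀ {a m′} → (a , m′) ∈ p → ∑K.∑ (λ m → h m * indicator m m′) M ≈ h m′
    pick {m′ = m′} am′∈ = trans
      (∑K.∑-single unique-M (supp⊆M am′∈) (λ _ m≢m′ → trans (*-congˡ (indicator-≢ (m≢m′ ∘ ≡.sym))) (zeroʳ _)))
      (trans (*-congˡ (indicator-refl m′)) (*-identityʳ _))

  ≃⇒≈P : ∀ {p q} → p ≃ q → p ≈P q
  ≃⇒≈P {p} {q} p≃q m =
    trans (coeff≈eval-indicator p m) (trans (eval-≈ p≃q (indicator m)) (sym (coeff≈eval-indicator q m)))

  ≈P⇒≃ : ∀ {p q} → p ≈P q → p ≃ q
  ≈P⇒≃ {p} {q} p≈q = mk≃ λ h → begin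
    eval h p                         ≈⟨ eval≈∑coeff h p unique-M (⊆M ∘ ∈.∈-++⁺ˡ ∘ ∈.∈-map⁺ proj₂) ⟩
    ∑K.∑ (λ m → h m * coeff p m) M   ≈⟨ ∑K.∑-cong M (λ {m} _ → *-congˡ (p≈q m)) ⟩
    ∑K.∑ (λ m → h m * coeff q m) M   ≈⟨ eval≈∑coeff h q unique-M (⊆M ∘ ∈.∈-++⁺ʳ _ ∘ ∈.∈-map⁺ proj₂) ⟨
    eval h q                         ∎
    where
    M : List Mon
    M = deduplicate _≟M_ (map proj₂ p ++ map proj₂ q)
    unique-M : Unique M
    unique-M = UniqueDec.deduplicate-! _≟M_ _
    ⊆M : ∀ {m} → m ∈ map proj₂ p ++ map proj₂ q → m ∈ M
    ⊆M = ∈.∈-deduplicate⁺ _≟M_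

  ≃-isEquivalence : IsEquivalence _≃_
  ≃-isEquivalence = record
    { refl  = mk≃ λ _ → refl
    ; sym   = λ p≃q → mk≃ λ h → sym (eval-≈ p≃q h)
    ; trans = λ p≃q q≃r → mk≃ λ h → trans (eval-≈ p≃q h) (eval-≈ q≃r h)
    }

  ≡⇒≃ : ∀ {p q} → p ≡ q → p ≃ q
  ≡⇒≃ ≡.refl = IsEquivalence.refl ≃-isEquivalence

  negP : Poly → Poly
  negP = scale (- 1#)

  scale-cong : ∀ k {p q} → p ≃ q → scale k p ≃ scale k q
  scale-cong k {p} {q} p≃q = mk≃ λ h →
    trans (eval-scale h k p) (trans (*-congˡ (eval-≈ p≃q h)) (sym (eval-scale h k q)))

  scale-congˡ : ∀ {k k′} p → k ≈ k′ → scale k p ≃ scale k′ p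
  scale-congˡ {k} {k′} p k≈k′ = mk≃ λ h →
    trans (eval-scale h k p) (trans (*-congʳ k≈k′) (sym (eval-scale h k′ p)))

  ++-cong : ∀ {p p′ q q′} → p ≃ p′ → q ≃ q′ → p ++ q ≃ p′ ++ q′
  ++-cong {p} {p′} {q} {q′} p≃p′ q≃q′ = mk≃ λ h → begin
    eval h (p ++ q)        ≈⟨ eval-++ h p q ⟩
    eval h p + eval h q    ≈⟨ +-cong (eval-≈ p≃p′ h) (eval-≈ q≃q′ h) ⟩
    eval h p′ + eval h q′  ≈⟨ eval-++ h p′ q′ ⟨
    eval h (p′ ++ q′)      ∎

  ++-comm : ∀ p q → p ++ q ≃ q ++ p
  ++-comm p q = mk≃ λ h → trans (eval-++ h p q) (trans (+-comm _ _) (sym (eval-++ h q p)))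

  negP-inverseʳ : ∀ p → p ++ negP p ≃ []
  negP-inverseʳ p = mk≃ λ h → begin
    eval h (p ++ negP p)          ≈⟨ eval-++ h p (negP p) ⟩
    eval h p + eval h (negP p)    ≈⟨ +-congˡ (trans (eval-scale h (- 1#) p) (-1*x≈-x _)) ⟩
    eval h p - eval h p           ≈⟨ -‿inverseʳ _ ⟩
    0#                            ∎

  *P-cong : ∀ {p p′ q q′} → p ≃ p′ → q ≃ q′ → p *P q ≃ p′ *P q′
  *P-cong {p} {p′} {q} {q′} p≃p′ q≃q′ = mk≃ λ h → begin
    eval h (p *P q)                                      ≈⟨ eval-* h p q ⟩
    eval (λ m → eval (λ n → h (m ++ n)) q) p             ≈⟨ eval-≈ p≃p′ _ ⟩
    eval (λ m → eval (λ n → h (m ++ n)) q) p′            ≈⟨ eval-congʳ (λ m → eval-≈ q≃q′ _) p′ ⟩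
    eval (λ m → eval (λ n → h (m ++ n)) q′) p′           ≈⟨ eval-* h p′ q′ ⟨
    eval h (p′ *P q′)                                    ∎

  *P-assoc : ∀ p q r → (p *P q) *P r ≃ p *P (q *P r)
  *P-assoc p q r = mk≃ λ h → begin
    eval h ((p *P q) *P r)
      ≈⟨ trans (eval-* h (p *P q) r) (eval-* _ p q) ⟩
    eval (λ m → eval (λ n → eval (λ o → h ((m ++ n) ++ o)) r) q) p
      ≈⟨ eval-congʳ (λ m → eval-congʳ (λ n → eval-congʳ (λ o →
           reflexive (≡.cong h (List.++-assoc m n o))) r) q) p ⟩
    eval (λ m → eval (λ n → eval (λ o → h (m ++ (n ++ o))) r) q) p
      ≈⟨ trans (eval-* h p (q *P r)) (eval-congʳ (λ m → eval-* _ q r) p) ⟨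
    eval h (p *P (q *P r))
      ∎

  *P-identityˡ : ∀ p → oneP *P p ≃ p
  *P-identityˡ p = mk≃ λ h → trans (eval-* h oneP p) (eval-oneP (λ m → eval (λ n → h (m ++ n)) p))

  *P-identityʳ : ∀ p → p *P oneP ≃ p
  *P-identityʳ p = mk≃ λ h → trans (eval-* h p oneP)
    (eval-congʳ (λ m → trans (eval-oneP (λ n → h (m ++ n))) (reflexive (≡.cong h (List.++-identityʳ m)))) p)

  *P-distribʳ : ∀ r p q → (p ++ q) *P r ≃ (p *P r) ++ (q *P r)
  *P-distribʳ r p q = ≡⇒≃ (List.concatMap-++ _ p q)

  *P-distribˡ : ∀ p q r → p *P (q ++ r) ≃ (p *P q) ++ (p *P r)
  *P-distribˡ p q r = mk≃ λ h → begin
    eval h (p *P (q ++ r))                                  ≈⟨ eval-* h p (q ++ r) ⟩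
    eval (λ m → eval (λ n → h (m ++ n)) (q ++ r)) p          ≈⟨ eval-congʳ (λ m → eval-++ _ q r) p ⟩
    eval (λ m → eval (λ n → h (m ++ n)) q + eval (λ n → h (m ++ n)) r) p
                                                            ≈⟨ eval-+ʰ p ⟩
    eval (λ m → eval (λ n → h (m ++ n)) q) p + eval (λ m → eval (λ n → h (m ++ n)) r) p
                                                            ≈⟨ +-cong (eval-* h p q) (eval-* h p r) ⟨
    eval h (p *P q) + eval h (p *P r)                       ≈⟨ eval-++ h (p *P q) (p *P r) ⟨
    eval h ((p *P q) ++ (p *P r))                           ∎

  polyRing : Ring c (c ⊔ ℓ)
  polyRing = record
    { Carrier = Poly
    ; _≈_ = _≃_
    ; _+_ = _++_
    ; _*_ = _*P_
    ; -_ = negP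
    ; 0# = []
    ; 1# = oneP
    ; isRing = record
      { +-isAbelianGroup = record
        { isGroup = record
          { isMonoid = record
            { isSemigroup = record
              { isMagma = record { isEquivalence = ≃-isEquivalence ; ∙-cong = ++-cong }
              ; assoc = λ p q r → ≡⇒≃ (List.++-assoc p q r)
              }
            ; identity = (λ _ → ≡⇒≃ ≡.refl) , (λ p → ≡⇒≃ (List.++-identityʳ p))
            }
          ; inverse = (λ p → IsEquivalence.trans ≃-isEquivalence (++-comm (negP p) p) (negP-inverseʳ p))
                    , negP-inverseʳ
          ; ⁻¹-cong = scale-cong (- 1#)
          }
        ; comm = ++-comm
        }
      ; *-cong = *P-cong
      ; *-assoc = *P-assoc
      ; *-identity = *P-identityˡ , *P-identityʳ
      ; distrib = *P-distribˡ , *P-distribʳ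
      }
    }

  module P = Ring polyRing
  module ≃-Reasoning = Relation.Binary.Reasoning.Setoid P.setoid
  open ListSum P.+-commutativeMonoid public
  open ListSumDistrib P.semiring public

  *P-congˡ : ∀ p {q q′} → q ≃ q′ → p *P q ≃ p *P q′
  *P-congˡ p = P.*-congˡ {p}

  *P-congʳ : ∀ q {p p′} → p ≃ p′ → p *P q ≃ p′ *P q
  *P-congʳ q = P.*-congʳ {q}

  scale-*ˡ : ∀ k p q → scale k p *P q ≃ scale k (p *P q)
  scale-*ˡ k p q = mk≃ λ h → begin
    eval h (scale k p *P q)                      ≈⟨ eval-* h (scale k p) q ⟩
    eval (λ m → eval (λ n → h (m ++ n)) q) (scale k p) ≈⟨ eval-scale _ k p ⟩
    k * eval (λ m → eval (λ n → h (m ++ n)) q) p ≈⟨ *-congˡ (eval-* h p q) ⟨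
    k * eval h (p *P q)                          ≈⟨ eval-scale h k (p *P q) ⟨
    eval h (scale k (p *P q))                    ∎

  scale-*ʳ : ∀ k p q → p *P scale k q ≃ scale k (p *P q)
  scale-*ʳ k p q = mk≃ λ h → begin
    eval h (p *P scale k q)                          ≈⟨ eval-* h p (scale k q) ⟩
    eval (λ m → eval (λ n → h (m ++ n)) (scale k q)) p ≈⟨ eval-congʳ (λ m → eval-scale _ k q) p ⟩
    eval (λ m → k * eval (λ n → h (m ++ n)) q) p     ≈⟨ eval-*ʰ k p ⟩
    k * eval (λ m → eval (λ n → h (m ++ n)) q) p     ≈⟨ *-congˡ (eval-* h p q) ⟨
    k * eval h (p *P q)                              ≈⟨ eval-scale h k (p *P q) ⟨
    eval h (scale k (p *P q))                        ∎

  scale-1 : ∀ p → scale 1# p ≃ p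
  scale-1 p = mk≃ λ h → trans (eval-scale h 1# p) (*-identityˡ _)

  scale-0 : ∀ p → scale 0# p ≃ []
  scale-0 p = mk≃ λ h → trans (eval-scale h 0# p) (zeroˡ _)

  scale-≈1 : ∀ {k} p → k ≈ 1# → scale k p ≃ p
  scale-≈1 p k≈1 = P.trans (scale-congˡ p k≈1) (scale-1 p)

  scale-≈0 : ∀ {k} p → k ≈ 0# → scale k p ≃ []
  scale-≈0 p k≈0 = P.trans (scale-congˡ p k≈0) (scale-0 p)

  *P-vanishˡ : ∀ q {p} → p ≃ [] → p *P q ≃ []
  *P-vanishˡ q p≃0 = P.trans (*P-congʳ q p≃0) (P.zeroˡ q)

  *P-vanishʳ : ∀ p {q} → q ≃ [] → p *P q ≃ []
  *P-vanishʳ p q≃0 = P.trans (*P-congˡ p q≃0) (P.zeroʳ p)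

  scale-oneP-central : ∀ k p q → p *P (scale k oneP *P q) ≃ scale k (p *P q)
  scale-oneP-central k p q =
    P.trans (*P-congˡ p (P.trans (scale-*ˡ k oneP q) (scale-cong k (P.*-identityˡ q)))) (scale-*ʳ k p q)

  scale-scale : ∀ k k′ p → scale k (scale k′ p) ≃ scale (k * k′) p
  scale-scale k k′ p = mk≃ λ h → begin
    eval h (scale k (scale k′ p)) ≈⟨ trans (eval-scale h k (scale k′ p)) (*-congˡ (eval-scale h k′ p)) ⟩
    k * (k′ * eval h p)          ≈⟨ *-assoc k k′ _ ⟨
    k * k′ * eval h p            ≈⟨ eval-scale h (k * k′) p ⟨
    eval h (scale (k * k′) p)    ∎

  scale-*P-scale : ∀ a b p q → scale a p *P scale b q ≃ scale (a * b) (p *P q)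
  scale-*P-scale a b p q =
    P.trans (scale-*ˡ a p (scale b q)) (P.trans (scale-cong a (scale-*ʳ b p q)) (scale-scale a b (p *P q)))

  scale-∑ : ∀ k (f : A → Poly) xs → scale k (∑ f xs) ≃ ∑ (scale k ∘ f) xs
  scale-∑ k f []       = P.refl
  scale-∑ k f (x ∷ xs) = P.trans (≡⇒≃ (List.map-++ _ (f x) (∑ f xs))) (P.+-congˡ (scale-∑ k f xs))

  linExt-cong : ∀ (f : Mon → Poly) {p q} → p ≃ q → linExt f p ≃ linExt f q
  linExt-cong f {p} {q} p≃q = mk≃ λ h →
    trans (eval-linExt f h p) (trans (eval-≈ p≃q _) (sym (eval-linExt f h q)))

  prodP-++ : ∀ ps qs → prodP (ps ++ qs) ≃ prodP ps *P prodP qs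
  prodP-++ []       qs = P.sym (P.*-identityˡ _)
  prodP-++ (p ∷ ps) qs = P.trans (*P-congˡ p (prodP-++ ps qs)) (P.sym (P.*-assoc p (prodP ps) (prodP qs)))

  linExt-scale : ∀ (f : Mon → Poly) k p → linExt f (scale k p) ≃ scale k (linExt f p)
  linExt-scale f k p = mk≃ λ h → begin
    eval h (linExt f (scale k p))            ≈⟨ eval-linExt f h (scale k p) ⟩
    eval (λ m → eval h (f m)) (scale k p)    ≈⟨ eval-scale _ k p ⟩
    k * eval (λ m → eval h (f m)) p          ≈⟨ *-congˡ (eval-linExt f h p) ⟨
    k * eval h (linExt f p)                  ≈⟨ eval-scale h k (linExt f p) ⟨
    eval h (scale k (linExt f p))            ∎

module ColouredSplittings {c ℓ} (R : CommutativeRing c ℓ) (N : ℕ) where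
  open Lagrange R N
  open Enumeration

  IsSplitting : Word → List Word → Set
  IsSplitting u Cs = All NonEmpty Cs × concat Cs ≡ u

  splits-enumerates : ∀ u → Enumerates (IsSplitting u) (splits u)
  splits-enumerates [] = record
    { unique = All.[] ∷ [] ; sound = λ { (here ≡.refl) → [] , ≡.refl } ; complete = complete₀ }
    where
    complete₀ : ∀ {Cs} → IsSplitting [] Cs → Cs ∈ splits []
    complete₀ {[]}          _            = here ≡.refl
    complete₀ {[] ∷ _}      (() ∷ _ , _)
    complete₀ {(_ ∷ _) ∷ _} (_ , ())
  splits-enumerates (x ∷ xs) =
    Enumerates-resp sound′ complete′ (concatMap⁺ (splits-enumerates xs) extensions-unique sameTail)
    where
    extensions : List Word → List (List Word)
    extensions s = ((x ∷ []) ∷ s) ∷ attach x s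
    dropHead : List Word → List Word
    dropHead ((_ ∷ [])    ∷ Cs) = Cs
    dropHead ((_ ∷ b ∷ w) ∷ Cs) = (b ∷ w) ∷ Cs
    dropHead _                  = []
    dropHead-extensions : ∀ {s Cs} → IsSplitting xs s → Cs ∈ extensions s → dropHead Cs ≡ s
    dropHead-extensions                 _            (here ≡.refl)         = ≡.refl
    dropHead-extensions {(_ ∷ _) ∷ _}   _            (there (here ≡.refl)) = ≡.refl
    dropHead-extensions {[] ∷ _}        (() ∷ _ , _) (there (here ≡.refl))
    extensions-unique : ∀ {s} → IsSplitting xs s → Unique (extensions s)
    extensions-unique {[]}          _            = All.[] ∷ []
    extensions-unique {(_ ∷ _) ∷ _} _            = ((λ ()) ∷ []) ∷ [] ∷ []
    extensions-unique {[] ∷ _}      (() ∷ _ , _)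
    sameTail : ∀ {s s′ Cs} → IsSplitting xs s → IsSplitting xs s′ →
               Cs ∈ extensions s → Cs ∈ extensions s′ → s ≡ s′
    sameTail s-ok s′-ok Cs∈ Cs∈′ =
      ≡.trans (≡.sym (dropHead-extensions s-ok Cs∈)) (dropHead-extensions s′-ok Cs∈′)
    sound′ : ∀ {Cs} → (∃ λ s → IsSplitting xs s × Cs ∈ extensions s) → IsSplitting (x ∷ xs) Cs
    sound′ (_           , (ne     , s≡) , here ≡.refl)         = (tt ∷ ne) , ≡.cong (x ∷_) s≡
    sound′ ((_ ∷ _) ∷ _ , (_ ∷ ne , s≡) , there (here ≡.refl)) = (tt ∷ ne) , ≡.cong (x ∷_) s≡
    complete′ : ∀ {Cs} → IsSplitting (x ∷ xs) Cs → ∃ λ s → IsSplitting xs s × Cs ∈ extensions s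
    complete′ {(_ ∷ [])    ∷ Cs} (_ ∷ ne , Cs≡) with ≡.refl , Cs≡′ ← List.∷-injective Cs≡ =
      Cs , (ne , Cs≡′) , here ≡.refl
    complete′ {(_ ∷ b ∷ w) ∷ Cs} (_ ∷ ne , Cs≡) with ≡.refl , Cs≡′ ← List.∷-injective Cs≡ =
      (b ∷ w) ∷ Cs , (tt ∷ ne , Cs≡′) , there (here ≡.refl)
    complete′ {[] ∷ _}           (() ∷ _ , _)

  words-enumerates : ∀ q → Enumerates (λ v → length v ≡ q) (words q)
  words-enumerates zero = record
    { unique = All.[] ∷ []
    ; sound = λ { (here ≡.refl) → ≡.refl }
    ; complete = λ { {[]} _ → here ≡.refl }
    }
  words-enumerates (suc q) =
    Enumerates-resp sound′ complete′
      (concatMap⁺ allColours (λ _ → Unique.map⁺ List.∷-injectiveʳ (unique IH)) sameHead)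
    where
    IH : Enumerates (λ v → length v ≡ q) (words q)
    IH = words-enumerates q
    allColours : Enumerates (λ _ → ⊤) (allFin N)
    allColours = record { unique = Unique.allFin⁺ N ; sound = _ ; complete = λ _ → ∈.∈-allFin _ }
    sameHead : ∀ {j j′ v} → ⊤ → ⊤ → v ∈ map (j ∷_) (words q) → v ∈ map (j′ ∷_) (words q) → j ≡ j′
    sameHead _ _ v∈ v∈′ with _ , _ , ≡.refl ← ∈.∈-map⁻ _ v∈ | _ , _ , ≡.refl ← ∈.∈-map⁻ _ v∈′ = ≡.refl
    sound′ : ∀ {v} → (∃ λ j → ⊤ × v ∈ map (j ∷_) (words q)) → length v ≡ suc q
    sound′ (_ , _ , v∈) with _ , w∈ , ≡.refl ← ∈.∈-map⁻ _ v∈ = ≡.cong suc (sound IH w∈)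
    complete′ : ∀ {v} → length v ≡ suc q → ∃ λ j → ⊤ × v ∈ map (j ∷_) (words q)
    complete′ {j ∷ w} |v|≡ = j , tt , ∈.∈-map⁺ _ (complete IH (ℕ.suc-injective |v|≡))

  ColouredSplitting : Set
  ColouredSplitting = List (Color × Word)

  colours : ColouredSplitting → Word
  colours = map proj₁

  blocks : ColouredSplitting → List Word
  blocks = map proj₂

  joined : ColouredSplitting → Word
  joined P = concat (blocks P)

  IsColouredSplitting : Word → ColouredSplitting → Set
  IsColouredSplitting u P = IsSplitting u (blocks P)

  colouredSplittings : Word → List ColouredSplitting
  colouredSplittings u = concatMap (λ Cs → map (λ v → zip v Cs) (words (length Cs))) (splits u)

  colouredSplittings-enumerates : ∀ u → Enumerates (IsColouredSplitting u) (colouredSplittings u)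
  colouredSplittings-enumerates u =
    Enumerates-resp sound′ complete′ (concatMap⁺ (splits-enumerates u) unique-colourings sameBlocks)
    where
    colourings : List Word → List ColouredSplitting
    colourings Cs = map (λ v → zip v Cs) (words (length Cs))
    blocks-colourings : ∀ {Cs P} → P ∈ colourings Cs → blocks P ≡ Cs
    blocks-colourings {Cs} P∈ with v , v∈ , ≡.refl ← ∈.∈-map⁻ _ P∈ =
      map-proj₂-zip v Cs (sound (words-enumerates _) v∈)
    unique-colourings : ∀ {Cs} → IsSplitting u Cs → Unique (colourings Cs)
    unique-colourings {Cs} _ = unique (map⁺ (λ v → zip v Cs) (words-enumerates (length Cs)) injective)
      where
      injective : ∀ {v v′} → length v ≡ length Cs → length v′ ≡ length Cs → zip v Cs ≡ zip v′ Cs → v ≡ v′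
      injective {v} {v′} |v| |v′| zip≡ = begin
        v                      ≡⟨ map-proj₁-zip v Cs |v| ⟨
        map proj₁ (zip v Cs)   ≡⟨ ≡.cong (map proj₁) zip≡ ⟩
        map proj₁ (zip v′ Cs)  ≡⟨ map-proj₁-zip v′ Cs |v′| ⟩
        v′                     ∎
        where open ≡.≡-Reasoning
    sameBlocks : ∀ {Cs Cs′ P} → IsSplitting u Cs → IsSplitting u Cs′ →
                 P ∈ colourings Cs → P ∈ colourings Cs′ → Cs ≡ Cs′
    sameBlocks _ _ P∈ P∈′ = ≡.trans (≡.sym (blocks-colourings P∈)) (blocks-colourings P∈′)
    sound′ : ∀ {P} → (∃ λ Cs → IsSplitting u Cs × P ∈ colourings Cs) → IsColouredSplitting u P
    sound′ (Cs , Cs-ok , P∈) = ≡.subst (IsSplitting u) (≡.sym (blocks-colourings P∈)) Cs-ok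
    complete′ : ∀ {P} → IsColouredSplitting u P → ∃ λ Cs → IsSplitting u Cs × P ∈ colourings Cs
    complete′ {P} P-ok = blocks P , P-ok ,
      ≡.subst (_∈ colourings (blocks P)) (zip-map-proj P)
              (∈.∈-map⁺ _ (complete (words-enumerates _) |v|≡|Cs|))
      where
      |v|≡|Cs| : length (colours P) ≡ length (blocks P)
      |v|≡|Cs| = ≡.trans (List.length-map proj₁ P) (≡.sym (List.length-map proj₂ P))

  IsProperColouredSplitting : Word → ColouredSplitting → Set
  IsProperColouredSplitting u P = IsColouredSplitting u P × 2 ≤ length P

  properColouredSplittings : Word → List ColouredSplitting
  properColouredSplittings u = filter (λ P → 2 ≤? length P) (colouredSplittings u)

  properColouredSplittings-enumerates : ∀ u →
    Enumerates (IsProperColouredSplitting u) (properColouredSplittings u)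
  properColouredSplittings-enumerates u = filter⁺ (λ P → 2 ≤? length P) (colouredSplittings-enumerates u)

  length-<-proper : ∀ {u P j C} → IsProperColouredSplitting u P → (j , C) ∈ P → length C < length u
  length-<-proper {P = P} ((ne , ≡.refl) , 2≤|P|) jC∈ =
    length-<-concat (blocks P) ne (≡.subst (2 ≤_) (≡.sym (List.length-map proj₂ P)) 2≤|P|)
                    (∈.∈-map⁺ proj₂ jC∈)

  proper⇒2≤length : ∀ {u P} → IsProperColouredSplitting u P → 2 ≤ length u
  proper⇒2≤length {P = []}                ((_ , _) , ())
  proper⇒2≤length {P = (_ , []) ∷ _}      (((() ∷ _) , _) , _)
  proper⇒2≤length {P = (j , x ∷ C) ∷ _} P-ok =
    ℕ.≤-trans (s≤s (s≤s z≤n)) (length-<-proper {j = j} {C = x ∷ C} P-ok (here ≡.refl))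

  diagonal : Word → ColouredSplitting
  diagonal = map (λ a → a , [ a ])

  colours-diagonal : ∀ u → colours (diagonal u) ≡ u
  colours-diagonal []      = ≡.refl
  colours-diagonal (a ∷ u) = ≡.cong (a ∷_) (colours-diagonal u)

  joined-diagonal : ∀ u → joined (diagonal u) ≡ u
  joined-diagonal []      = ≡.refl
  joined-diagonal (a ∷ u) = ≡.cong (a ∷_) (joined-diagonal u)

  diagonal-isColouredSplitting : ∀ u → IsColouredSplitting u (diagonal u)
  diagonal-isColouredSplitting u = nonEmpty u , joined-diagonal u
    where
    nonEmpty : ∀ v → All NonEmpty (blocks (diagonal v))
    nonEmpty []      = []
    nonEmpty (a ∷ v) = tt ∷ nonEmpty v

module ReducedTrees {c ℓ} (R : CommutativeRing c ℓ) (N : ℕ) where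
  open Lagrange R N
  open ColouredSplittings R N
  open Enumeration

  _≟W_ : DecidableEquality Word
  _≟W_ = List.≡-dec _≟F_

  InRT′ : Color × Word → Tree → Set
  InRT′ (j , C) = InRT j C

  rootAndLeaves : Tree → Color × Word
  rootAndLeaves T = rootColor T , leafColors T

  IsLeaf : Color → Word → Tree → Set
  IsLeaf i v T = v ≡ [ i ] × T ≡ node i []

  IsInnerNode : Color → Word → Tree → Set
  IsInnerNode i v T =
    ∃ λ P → IsProperColouredSplitting v P × ∃ λ ts → Pointwise InRT′ P ts × node i ts ≡ T

  Pointwise⇒≡ : ∀ {P ts} → Pointwise InRT′ P ts → P ≡ map rootAndLeaves ts
  Pointwise⇒≡ []                            = ≡.refl
  Pointwise⇒≡ ((≡.refl , ≡.refl , _) ∷ rest) = ≡.cong (_ ∷_) (Pointwise⇒≡ rest)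

  leafColors-nonEmpty : ∀ T → NonEmpty (leafColors T)
  leafColors-nonEmpty (node x [])       = tt
  leafColors-nonEmpty (node x (t ∷ ts)) with leafColors t | leafColors-nonEmpty t
  ... | _ ∷ _ | _ = tt

  blocks-nonEmpty : ∀ ts → All NonEmpty (blocks (map rootAndLeaves ts))
  blocks-nonEmpty []       = []
  blocks-nonEmpty (t ∷ ts) = leafColors-nonEmpty t ∷ blocks-nonEmpty ts

  joined-rootAndLeaves : ∀ ts → joined (map rootAndLeaves ts) ≡ leafColorsL ts
  joined-rootAndLeaves []       = ≡.refl
  joined-rootAndLeaves (t ∷ ts) = ≡.cong (leafColors t ++_) (joined-rootAndLeaves ts)

  reduced⇒pointwise : ∀ ts → ReducedL ts → Pointwise InRT′ (map rootAndLeaves ts) ts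
  reduced⇒pointwise []       _          = []
  reduced⇒pointwise (t ∷ ts) (red , reds) = (≡.refl , ≡.refl , red) ∷ reduced⇒pointwise ts reds

  pointwise⇒reduced : ∀ {P ts} → Pointwise InRT′ P ts → ReducedL ts
  pointwise⇒reduced []                 = tt
  pointwise⇒reduced ((_ , _ , red) ∷ pw) = red , pointwise⇒reduced pw

  InRT-cases : ∀ {i v T} → InRT i v T → IsLeaf i v T ⊎ IsInnerNode i v T
  InRT-cases {T = node x []}                (≡.refl , ≡.refl , _)        = inj₁ (≡.refl , ≡.refl)
  InRT-cases {T = node x (t ∷ [])}          (_ , _ , not-unary , _)      = ⊥-elim (not-unary ≡.refl)
  InRT-cases {T = node x ts@(_ ∷ _ ∷ _)}    (≡.refl , ≡.refl , _ , reds) =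
    inj₂ (map rootAndLeaves ts , ((blocks-nonEmpty ts , joined-rootAndLeaves ts) , s≤s (s≤s z≤n)) ,
          ts , reduced⇒pointwise ts reds , ≡.refl)

  leaf⇒InRT : ∀ {i v T} → IsLeaf i v T → InRT i v T
  leaf⇒InRT (≡.refl , ≡.refl) = ≡.refl , ≡.refl , (λ ()) , tt

  innerNode⇒InRT : ∀ {i v T} → IsInnerNode i v T → InRT i v T
  innerNode⇒InRT (_ , ((_ , joined≡v) , _) , ts@(_ ∷ _ ∷ _) , pw , ≡.refl) with ≡.refl ← Pointwise⇒≡ pw =
    ≡.refl , ≡.trans (≡.sym (joined-rootAndLeaves ts)) joined≡v , (λ ()) , pointwise⇒reduced pw
  innerNode⇒InRT (_ , (_ , 2≤|P|) , _ ∷ [] , pw , _) with ≡.refl ← Pointwise⇒≡ pw with s≤s () ← 2≤|P|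
  innerNode⇒InRT (_ , (_ , 2≤|P|) , []     , [] , _) with () ← 2≤|P|

  leaves : Color → Word → List Tree
  leaves i v with v ≟W [ i ]
  ... | yes _ = [ node i [] ]
  ... | no  _ = []

  leaves-enumerates : ∀ i v → Enumerates (IsLeaf i v) (leaves i v)
  leaves-enumerates i v with v ≟W [ i ]
  ... | yes v≡i = record
    { unique = [] ∷ [] ; sound = λ { (here T≡) → v≡i , T≡ } ; complete = λ (_ , T≡) → here T≡ }
  ... | no  v≢i = record { unique = [] ; sound = λ () ; complete = λ (v≡i , _) → ⊥-elim (v≢i v≡i) }

  -- trees n i v lists RT^i_v as soon as n ≥ |v|, since the blocks of a proper splitting are
  -- strictly shorter (length-<-proper).
  mutual
    trees : ℕ → Color → Word → List Tree
    trees zero    i v = []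
    trees (suc n) i v = leaves i v ++ concatMap (innerNodes n i) (properColouredSplittings v)

    innerNodes : ℕ → Color → ColouredSplitting → List Tree
    innerNodes n i P = map (node i) (choices (map (uncurry (trees n)) P))

  node-injective : ∀ {i ts ts′} → node i ts ≡ node i ts′ → ts ≡ ts′
  node-injective ≡.refl = ≡.refl

  mutual
    trees-enumerates : ∀ n {i v} → length v ≤ n → Enumerates (InRT i v) (trees n i v)
    trees-enumerates zero {v = []} _ = record
      { unique = [] ; sound = λ () ; complete = λ {T} (_ , leaves≡[] , _) → ⊥-elim (noLeaves T leaves≡[]) }
      where
      noLeaves : ∀ T → leafColors T ≢ []
      noLeaves T leaves≡[] with leafColors T | leafColors-nonEmpty T
      noLeaves T () | _ ∷ _ | _
    trees-enumerates zero {v = _ ∷ _} ()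
    trees-enumerates (suc n) {i} {v} |v|≤ =
      Enumerates-resp [ leaf⇒InRT , innerNode⇒InRT ]′ InRT-cases
        (++⁺ (leaves-enumerates i v) innerNodes-enumerates leaf-not-inner)
      where
      nodesOver : ∀ {P} → IsProperColouredSplitting v P →
                  Enumerates (λ T → ∃ λ ts → Pointwise InRT′ P ts × node i ts ≡ T) (innerNodes n i P)
      nodesOver P-ok = map⁺ (node i) (subtrees-enumerates n |v|≤ P-ok) (λ _ _ → node-injective)
      sameSplitting : ∀ {P P′ T} → IsProperColouredSplitting v P → IsProperColouredSplitting v P′ →
                      T ∈ innerNodes n i P → T ∈ innerNodes n i P′ → P ≡ P′
      sameSplitting P-ok P′-ok T∈ T∈′
        with _ , pw , ≡.refl ← sound (nodesOver P-ok) T∈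
        with _ , pw′ , ≡.refl ← sound (nodesOver P′-ok) T∈′ =
        ≡.trans (Pointwise⇒≡ pw) (≡.sym (Pointwise⇒≡ pw′))
      innerNodes-enumerates :
        Enumerates (IsInnerNode i v) (concatMap (innerNodes n i) (properColouredSplittings v))
      innerNodes-enumerates = Enumerates-resp
        (λ (P , P-ok , T∈) → P , P-ok , sound (nodesOver P-ok) T∈)
        (λ (P , P-ok , T-ok) → P , P-ok , complete (nodesOver P-ok) T-ok)
        (concatMap⁺ (properColouredSplittings-enumerates v) (unique ∘ nodesOver) sameSplitting)
      leaf-not-inner : ∀ {T} → IsLeaf i v T → IsInnerNode i v T → ⊥
      leaf-not-inner (_ , ≡.refl) (_ , (_ , 2≤|P|) , [] , pw , ≡.refl)
        with ≡.refl ← Pointwise⇒≡ pw with () ← 2≤|P|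

    subtrees-enumerates : ∀ n {v P} → length v ≤ suc n → IsProperColouredSplitting v P →
                         Enumerates (Pointwise InRT′ P) (choices (map (uncurry (trees n)) P))
    subtrees-enumerates n {P = P} |v|≤ P-ok = choices⁺ (uncurry (trees n)) P λ jC∈ →
      trees-enumerates n (ℕ.≤-pred (ℕ.≤-trans (length-<-proper P-ok jC∈) |v|≤))

module TreeSums {c ℓ} (R : CommutativeRing c ℓ) (N : ℕ) where
  open Lagrange R N
  private module K = CommutativeRing R
  open FreeAlgebra R N
  open ColouredSplittings R N
  open ReducedTrees R N
  open Enumeration
  open import Algebra.Properties.Ring polyRing using (-‿distribˡ-*)
  open ≃-Reasoning

  weight : Tree → Poly
  weight T = scale (sign (vT T)) (ΛL T)

  treeSum : Color → Word → Poly
  treeSum i v = ∑ weight (trees (length v) i v)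

  treeSum-enumeration : ∀ {i v Ts} → Enumerates (InRT i v) Ts → ∑ weight Ts ≃ treeSum i v
  treeSum-enumeration {v = v} E = ∑-↭ weight (Enumerates⇒↭ E (trees-enumerates (length v) ℕ.≤-refl))

  sign-+ : ∀ m n → sign (m ℕ.+ n) K.≈ sign m K.* sign n
  sign-+ zero    n = K.sym (K.*-identityˡ _)
  sign-+ (suc m) n = K.trans (K.*-congˡ (sign-+ m n)) (K.sym (K.*-assoc _ _ _))

  prodP-reverse : ∀ ps → prodP (reverse ps) ≃ ∏ʳ ps
  prodP-reverse []       = P.refl
  prodP-reverse (p ∷ ps) = begin
    prodP (reverse (p ∷ ps))          ≡⟨ ≡.cong prodP (List.unfold-reverse p ps) ⟩
    prodP (reverse ps ++ [ p ])       ≈⟨ prodP-++ (reverse ps) [ p ] ⟩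
    prodP (reverse ps) *P prodP [ p ] ≈⟨ P.*-cong (prodP-reverse ps) (P.*-identityʳ p) ⟩
    ∏ʳ ps *P p                        ∎

  signedProduct : List Poly → Poly
  signedProduct ps = scale (sign (length ps)) (∏ʳ ps)

  signedProduct-++ : ∀ ps qs → signedProduct (ps ++ qs) ≃ signedProduct qs *P signedProduct ps
  signedProduct-++ ps qs = begin
    scale (sign (length (ps ++ qs))) (∏ʳ (ps ++ qs))
      ≈⟨ scale-cong _ (∏ʳ-++ ps qs) ⟩
    scale (sign (length (ps ++ qs))) (∏ʳ qs *P ∏ʳ ps)
      ≈⟨ scale-congˡ _ sign-++ ⟩
    scale (sign (length qs) K.* sign (length ps)) (∏ʳ qs *P ∏ʳ ps)
      ≈⟨ scale-*P-scale _ _ (∏ʳ qs) (∏ʳ ps) ⟨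
    signedProduct qs *P signedProduct ps
      ∎
    where
    sign-++ : sign (length (ps ++ qs)) K.≈ sign (length qs) K.* sign (length ps)
    sign-++ = K.trans (K.reflexive (≡.cong sign (List.length-++ ps)))
                      (K.trans (sign-+ (length ps) (length qs)) (K.*-comm _ _))

  weight≃signedProduct : ∀ T → weight T ≃ signedProduct (postY T)
  weight≃signedProduct T = scale-cong _ (prodP-reverse (postY T))

  signedProduct-postYL : ∀ ts → signedProduct (postYL ts) ≃ ∏ʳ (map weight ts)
  signedProduct-postYL []       = scale-1 oneP
  signedProduct-postYL (t ∷ ts) = begin
    signedProduct (postY t ++ postYL ts)
      ≈⟨ signedProduct-++ (postY t) (postYL ts) ⟩
    signedProduct (postYL ts) *P signedProduct (postY t)
      ≈⟨ P.*-cong (signedProduct-postYL ts) (P.sym (weight≃signedProduct t)) ⟩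
    ∏ʳ (map weight ts) *P weight t
      ∎

  -- Λ_{↓L} lists the root first, then the subtrees from right to left.
  weight-node : ∀ x t ts →
                weight (node x (t ∷ ts)) ≃ P.- (Y x (map rootColor (t ∷ ts)) *P ∏ʳ (map weight (t ∷ ts)))
  weight-node x t ts = begin
    weight (node x (t ∷ ts))
      ≈⟨ weight≃signedProduct (node x (t ∷ ts)) ⟩
    signedProduct (postYL (t ∷ ts) ++ [ y ])
      ≈⟨ signedProduct-++ (postYL (t ∷ ts)) [ y ] ⟩
    signedProduct [ y ] *P signedProduct (postYL (t ∷ ts))
      ≈⟨ P.*-cong signedProduct-y (signedProduct-postYL (t ∷ ts)) ⟩
    (P.- y) *P ∏ʳ (map weight (t ∷ ts))
      ≈⟨ -‿distribˡ-* y _ ⟨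
    P.- (y *P ∏ʳ (map weight (t ∷ ts)))
      ∎
    where
    y : Poly
    y = Y x (map rootColor (t ∷ ts))
    signedProduct-y : signedProduct [ y ] ≃ P.- y
    signedProduct-y = P.trans (scale-cong _ (P.*-identityˡ y)) (scale-congˡ y (K.*-identityʳ (K.- K.1#)))

  δK : Color → Word → K.Carrier
  δK i v with v ≟W [ i ]
  ... | yes _ = K.1#
  ... | no  _ = K.0#

  δ : Color → Word → Poly
  δ i v = scale (δK i v) oneP

  δK-refl : ∀ i → δK i [ i ] K.≈ K.1#
  δK-refl i with [ i ] ≟W [ i ]
  ... | yes _   = K.refl
  ... | no  i≢i = ⊥-elim (i≢i ≡.refl)

  δK-≢ : ∀ {i v} → v ≢ [ i ] → δK i v K.≈ K.0#
  δK-≢ {i} {v} v≢i with v ≟W [ i ]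
  ... | yes v≡i = ⊥-elim (v≢i v≡i)
  ... | no  _   = K.refl

  Y-letter : ∀ i j → Y i [ j ] ≃ δ i [ j ]
  Y-letter i j with i ≟F j | [ j ] ≟W [ i ]
  ... | yes _   | yes _   = P.sym (scale-1 oneP)
  ... | no  _   | no  _   = P.sym (scale-0 oneP)
  ... | yes i≡j | no  j≢i = ⊥-elim (j≢i (≡.cong [_] (≡.sym i≡j)))
  ... | no  i≢j | yes j≡i = ⊥-elim (i≢j (≡.sym (List.∷-injectiveˡ j≡i)))

  ∑-leaves : ∀ i v → ∑ weight (leaves i v) ≃ δ i v
  ∑-leaves i v with v ≟W [ i ]
  ... | yes _ = P.refl
  ... | no  _ = P.sym (scale-0 oneP)

  branchSum : (Color → Word → Poly) → Color → Word → Poly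
  branchSum G i v = ∑ (λ P → Y i (colours P) *P ∏ʳ (map (uncurry G) P)) (properColouredSplittings v)

  weight-innerNode : ∀ {i P ts} → Pointwise InRT′ P ts → 2 ≤ length P →
                     weight (node i ts) ≃ P.- (Y i (colours P) *P ∏ʳ (map weight ts))
  weight-innerNode {ts = []}     [] ()
  weight-innerNode {i} {ts = t ∷ ts} pw _ with ≡.refl ← Pointwise⇒≡ pw =
    ≡.subst (λ cs → weight (node i (t ∷ ts)) ≃ P.- (Y i cs *P ∏ʳ (map weight (t ∷ ts))))
            (List.map-∘ (t ∷ ts)) (weight-node i t ts)

  treeSum-rec : ∀ i v → treeSum i v ≃ δ i v P.- branchSum treeSum i v
  treeSum-rec i []         = P.sym (P.trans (P.+-congʳ (scale-0 oneP)) (P.-‿inverseʳ []))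
  treeSum-rec i v@(_ ∷ v′) = begin
    ∑ weight (leaves i v ++ concatMap (innerNodes n i) (properColouredSplittings v))
      ≈⟨ ∑-++ weight (leaves i v) _ ⟩
    ∑ weight (leaves i v) ++ ∑ weight (concatMap (innerNodes n i) (properColouredSplittings v))
      ≈⟨ P.+-cong (∑-leaves i v) (∑-concatMap weight (innerNodes n i) (properColouredSplittings v)) ⟩
    δ i v ++ ∑ (∑ weight ∘ innerNodes n i) (properColouredSplittings v)
      ≈⟨ P.+-congˡ (∑-cong (properColouredSplittings v) ∑-inner) ⟩
    δ i v ++ ∑ (λ P → P.- term P) (properColouredSplittings v)
      ≈⟨ P.+-congˡ (scale-∑ (K.- K.1#) term (properColouredSplittings v)) ⟨
    δ i v P.- branchSum treeSum i v
      ∎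
    where
    n : ℕ
    n = length v′
    term : ColouredSplitting → Poly
    term P = Y i (colours P) *P ∏ʳ (map (uncurry treeSum) P)
    ∑-inner : ∀ {P} → P ∈ properColouredSplittings v → ∑ weight (innerNodes n i P) ≃ P.- term P
    ∑-inner {P} P∈ = begin
      ∑ weight (map (node i) (choices Ls))
        ≡⟨ ∑-map weight (node i) (choices Ls) ⟩
      ∑ (weight ∘ node i) (choices Ls)
        ≈⟨ ∑-cong (choices Ls) (λ ts∈ → weight-innerNode (sound subtrees ts∈) (proj₂ P-ok)) ⟩
      ∑ (λ ts → P.- (y *P ∏ʳ (map weight ts))) (choices Ls)
        ≈⟨ scale-∑ (K.- K.1#) _ (choices Ls) ⟨
      P.- ∑ (λ ts → y *P ∏ʳ (map weight ts)) (choices Ls)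
        ≈⟨ P.-‿cong (∑-distribˡ y _ (choices Ls)) ⟨
      P.- (y *P ∑ (λ ts → ∏ʳ (map weight ts)) (choices Ls))
        ≈⟨ P.-‿cong (*P-congˡ y (∑-choices weight Ls)) ⟩
      P.- (y *P ∏ʳ (map (∑ weight) Ls))
        ≡⟨ ≡.cong (λ ps → P.- (y *P ∏ʳ ps)) (List.map-∘ P) ⟨
      P.- (y *P ∏ʳ (map (∑ weight ∘ uncurry (trees n)) P))
        ≈⟨ P.-‿cong (*P-congˡ y (∏ʳ-cong P (λ jC∈ → treeSum-enumeration (trees-enumerates n (|C|≤n jC∈))))) ⟩
      P.- term P
        ∎
      where
      P-ok : IsProperColouredSplitting v P
      P-ok = sound (properColouredSplittings-enumerates v) P∈
      Ls : List (List Tree)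
      Ls = map (uncurry (trees n)) P
      y : Poly
      y = Y i (colours P)
      subtrees : Enumerates (Pointwise InRT′ P) (choices Ls)
      subtrees = subtrees-enumerates n ℕ.≤-refl P-ok
      |C|≤n : ∀ {j C} → (j , C) ∈ P → length C ≤ n
      |C|≤n jC∈ = ℕ.≤-pred (length-<-proper P-ok jC∈)

module Refinements {c ℓ} (R : CommutativeRing c ℓ) (N : ℕ) where
  open Lagrange R N
  open ColouredSplittings R N
  open Enumeration

  Refines : Color × Word → ColouredSplitting → Set
  Refines (_ , C) = IsColouredSplitting C

  IsRefinement : Word → ColouredSplitting × List ColouredSplitting → Set
  IsRefinement u (Q , Ps) = IsProperColouredSplitting u Q × Pointwise Refines Q Ps

  IsCoarsening : Word → ColouredSplitting × ColouredSplitting → Set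
  IsCoarsening u (P , B) = IsColouredSplitting u P × IsProperColouredSplitting (colours P) B

  -- Splitting each block of Q further by Ps gives the finer splitting concat Ps of u; the
  -- blocks of Q then become the colour words of the Ps, which form a splitting B of colours (concat Ps).
  merge : ColouredSplitting × List ColouredSplitting → ColouredSplitting × ColouredSplitting
  merge (Q , Ps) = concat Ps , zip (colours Q) (map colours Ps)

  refines-length : ∀ {Q Ps} → Pointwise Refines Q Ps → length (colours Q) ≡ length (map colours Ps)
  refines-length {Q} {Ps} pw = begin
    length (colours Q)       ≡⟨ List.length-map proj₁ Q ⟩
    length Q                 ≡⟨ Pointwise-length pw ⟩
    length Ps                ≡⟨ List.length-map colours Ps ⟨
    length (map colours Ps)  ∎
    where open ≡.≡-Reasoning

  refines-blocks : ∀ {Q Ps} → Pointwise Refines Q Ps → blocks Q ≡ map joined Ps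
  refines-blocks []                    = ≡.refl
  refines-blocks ((_ , C≡) ∷ pw) = ≡.cong₂ _∷_ (≡.sym C≡) (refines-blocks pw)

  refines-nonEmpty : ∀ {Q Ps} → Pointwise Refines Q Ps → All (All NonEmpty ∘ blocks) Ps
  refines-nonEmpty []              = []
  refines-nonEmpty ((ne , _) ∷ pw) = ne ∷ refines-nonEmpty pw

  refines-nonEmptyColours : ∀ {Q Ps} → Pointwise Refines Q Ps → All NonEmpty (blocks Q) →
                            All (NonEmpty ∘ colours) Ps
  refines-nonEmptyColours []                              _          = []
  refines-nonEmptyColours {Ps = [] ∷ _}  ((_ , ≡.refl) ∷ _)  (() ∷ _)
  refines-nonEmptyColours {Ps = (_ ∷ _) ∷ _} (_ ∷ pw)      (_ ∷ ne)   = tt ∷ refines-nonEmptyColours pw ne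

  joined-concat : ∀ Ps → joined (concat Ps) ≡ concat (map joined Ps)
  joined-concat Ps = begin
    concat (blocks (concat Ps))              ≡⟨ ≡.cong concat (List.concat-map Ps) ⟨
    concat (concat (map blocks Ps))          ≡⟨ List.concat-concat (map blocks Ps) ⟨
    concat (map concat (map blocks Ps))      ≡⟨ ≡.cong concat (List.map-∘ Ps) ⟨
    concat (map joined Ps)                   ∎
    where open ≡.≡-Reasoning

  nonEmpty-joined : ∀ P → NonEmpty (colours P) → All NonEmpty (blocks P) → NonEmpty (joined P)
  nonEmpty-joined ((_ , _ ∷ _) ∷ _) _ _        = tt
  nonEmpty-joined ((_ , [])    ∷ _) _ (() ∷ _)

  merge-sound : ∀ {u x} → IsRefinement u x → IsCoarsening u (merge x)
  merge-sound {u} {Q , Ps} (((neQ , joinedQ≡u) , 2≤|Q|) , pw) =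
    (fine-nonEmpty , fine-joined) , (coarse-nonEmpty , coarse-joined) , 2≤|B|
    where
    blocks-B : blocks (zip (colours Q) (map colours Ps)) ≡ map colours Ps
    blocks-B = map-proj₂-zip (colours Q) (map colours Ps) (refines-length pw)
    fine-nonEmpty : All NonEmpty (blocks (concat Ps))
    fine-nonEmpty = ≡.subst (All NonEmpty) (List.concat-map Ps)
                      (All.concat⁺ (All.map⁺ (refines-nonEmpty pw)))
    fine-joined : joined (concat Ps) ≡ u
    fine-joined = ≡.trans (joined-concat Ps) (≡.trans (≡.cong concat (≡.sym (refines-blocks pw))) joinedQ≡u)
    coarse-nonEmpty : All NonEmpty (blocks (zip (colours Q) (map colours Ps)))
    coarse-nonEmpty = ≡.subst (All NonEmpty) (≡.sym blocks-B) (All.map⁺ (refines-nonEmptyColours pw neQ))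
    coarse-joined : joined (zip (colours Q) (map colours Ps)) ≡ colours (concat Ps)
    coarse-joined = ≡.trans (≡.cong concat blocks-B) (List.concat-map Ps)
    2≤|B| : 2 ≤ length (zip (colours Q) (map colours Ps))
    2≤|B| = ≡.subst (2 ≤_) length-B 2≤|Q|
      where
      length-B : length Q ≡ length (zip (colours Q) (map colours Ps))
      length-B = ≡.trans (≡.sym (List.length-map proj₁ Q))
        (≡.trans (≡.cong length (≡.sym (map-proj₁-zip (colours Q) (map colours Ps) (refines-length pw))))
                 (List.length-map proj₁ (zip (colours Q) (map colours Ps))))

  merge-injective : ∀ {u x y} → IsRefinement u x → IsRefinement u y → merge x ≡ merge y → x ≡ y
  merge-injective {x = Q , Ps} {Q′ , Ps′} (_ , pw) (_ , pw′) merge≡ = ≡.cong₂ _,_ Q≡Q′ Ps≡Ps′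
    where
    zip≡ : zip (colours Q) (map colours Ps) ≡ zip (colours Q′) (map colours Ps′)
    zip≡ = ≡.cong proj₂ merge≡
    colours≡ : colours Q ≡ colours Q′
    colours≡ = ≡.trans (≡.sym (map-proj₁-zip _ _ (refines-length pw)))
                 (≡.trans (≡.cong (map proj₁) zip≡) (map-proj₁-zip _ _ (refines-length pw′)))
    Ps≡Ps′ : Ps ≡ Ps′
    Ps≡Ps′ = concat-injective Ps Ps′
      (≡.trans (≡.sym (map-proj₂-zip _ _ (refines-length pw)))
        (≡.trans (≡.cong (map proj₂) zip≡) (map-proj₂-zip _ _ (refines-length pw′))))
      (≡.cong proj₁ merge≡)
    blocks≡ : blocks Q ≡ blocks Q′
    blocks≡ = ≡.trans (refines-blocks pw) (≡.trans (≡.cong (map joined) Ps≡Ps′) (≡.sym (refines-blocks pw′)))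
    Q≡Q′ : Q ≡ Q′
    Q≡Q′ = begin
      Q                             ≡⟨ zip-map-proj Q ⟨
      zip (colours Q) (blocks Q)    ≡⟨ ≡.cong₂ zip colours≡ blocks≡ ⟩
      zip (colours Q′) (blocks Q′)  ≡⟨ zip-map-proj Q′ ⟩
      Q′                            ∎
      where open ≡.≡-Reasoning

  refining : ∀ cs Ps → length cs ≡ length Ps → All (All NonEmpty ∘ blocks) Ps →
             Pointwise Refines (zip cs (map joined Ps)) Ps
  refining []       []       _         _        = []
  refining (c ∷ cs) (P ∷ Ps) |cs|≡|Ps| (ne ∷ nes) =
    (ne , ≡.refl) ∷ refining cs Ps (ℕ.suc-injective |cs|≡|Ps|) nes

  merge-complete : ∀ {u y} → IsCoarsening u y → ∃ λ x → IsRefinement u x × merge x ≡ y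
  merge-complete {u} {P , B} ((neP , joinedP≡u) , (neB , joinedB≡) , 2≤|B|)
    with Ps , ≡.refl , coloursPs≡ ← unconcat proj₁ (blocks B) P (≡.sym joinedB≡) =
    (Q , Ps) , (((neQ , joinedQ≡u) , 2≤|Q|) , refining (colours B) Ps |B|≡|Ps| nePs) ,
    ≡.cong (concat Ps ,_) zip≡B
    where
    |B|≡|Ps| : length (colours B) ≡ length Ps
    |B|≡|Ps| = ≡.trans (List.length-map proj₁ B) (≡.trans (≡.sym (List.length-map proj₂ B))
                 (≡.trans (≡.cong length (≡.sym coloursPs≡)) (List.length-map colours Ps)))
    |B|≡|joined| : length (colours B) ≡ length (map joined Ps)
    |B|≡|joined| = ≡.trans |B|≡|Ps| (≡.sym (List.length-map joined Ps))
    Q : ColouredSplitting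
    Q = zip (colours B) (map joined Ps)
    colours-Q : colours Q ≡ colours B
    colours-Q = map-proj₁-zip (colours B) (map joined Ps) |B|≡|joined|
    blocks-Q : blocks Q ≡ map joined Ps
    blocks-Q = map-proj₂-zip (colours B) (map joined Ps) |B|≡|joined|
    nePs : All (All NonEmpty ∘ blocks) Ps
    nePs = All.map⁻ (All.concat⁻ (≡.subst (All NonEmpty) (≡.sym (List.concat-map Ps)) neP))
    neQ : All NonEmpty (blocks Q)
    neQ = ≡.subst (All NonEmpty) (≡.sym blocks-Q)
      (All.map⁺ (All.zipWith (uncurry (nonEmpty-joined _))
        (All.map⁻ (≡.subst (All NonEmpty) (≡.sym coloursPs≡) neB) , nePs)))
    joinedQ≡u : joined Q ≡ u
    joinedQ≡u = ≡.trans (≡.cong concat blocks-Q) (≡.trans (≡.sym (joined-concat Ps)) joinedP≡u)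
    2≤|Q| : 2 ≤ length Q
    2≤|Q| = ≡.subst (2 ≤_) (≡.trans (≡.sym (List.length-map proj₁ B))
              (≡.trans (≡.cong length (≡.sym colours-Q)) (List.length-map proj₁ Q))) 2≤|B|
    zip≡B : zip (colours Q) (map colours Ps) ≡ B
    zip≡B = ≡.trans (≡.cong₂ zip colours-Q coloursPs≡) (zip-map-proj B)

  blockSplittings : ColouredSplitting → List (List ColouredSplitting)
  blockSplittings Q = choices (map (colouredSplittings ∘ proj₂) Q)

  blockSplittings-enumerates : ∀ Q → Enumerates (Pointwise Refines Q) (blockSplittings Q)
  blockSplittings-enumerates Q =
    choices⁺ (colouredSplittings ∘ proj₂) Q (λ _ → colouredSplittings-enumerates _)

  coarsenings-enumerates : ∀ u →
    Enumerates (IsCoarsening u) (pairs (colouredSplittings u) (properColouredSplittings ∘ colours))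
  coarsenings-enumerates u =
    pairs⁺ (colouredSplittings-enumerates u) (λ {P} _ → properColouredSplittings-enumerates (colours P))

  merges-enumerates : ∀ u →
    Enumerates (IsCoarsening u) (map merge (pairs (properColouredSplittings u) blockSplittings))
  merges-enumerates u = Enumerates-resp (λ { (x , x-ok , ≡.refl) → merge-sound x-ok }) merge-complete
    (map⁺ merge (pairs⁺ (properColouredSplittings-enumerates u) (λ {Q} _ → blockSplittings-enumerates Q))
          merge-injective)

module Convolution {c ℓ} (R : CommutativeRing c ℓ) (N : ℕ) where
  open Lagrange R N
  private module K = CommutativeRing R
  open FreeAlgebra R N
  open ColouredSplittings R N
  open ReducedTrees R N using (_≟W_)
  open TreeSums R N
  open Refinements R N
  open Enumeration
  open import Algebra.Properties.Ring polyRing using ([y-z]x≈yx-zx)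
  open import Algebra.Properties.AbelianGroup P.+-abelianGroup using (x∙y⁻¹≈ε⇒x≈y; x≈y⇒x∙y⁻¹≈ε)
  open ≃-Reasoning

  blockMonomial : ColouredSplitting → Poly
  blockMonomial P = prodP (map (uncurry Y) P)

  -- m ∘ (G ⊗ id) ∘ Δ^op applied to Y^i_u, when G i v stands for the image of Y^i_v.
  _⋆Y : (Color → Word → Poly) → Color → Word → Poly
  (G ⋆Y) i u = ∑ (λ P → G i (colours P) *P blockMonomial P) (colouredSplittings u)

  IsLeftInverseOfY : (Color → Word → Poly) → Set (c ⊔ ℓ)
  IsLeftInverseOfY G = ∀ i u → NonEmpty u → (G ⋆Y) i u ≃ δ i u

  ⋆Y-cong : ∀ {G G′} → (∀ j v → G j v ≃ G′ j v) → ∀ i u → (G ⋆Y) i u ≃ (G′ ⋆Y) i u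
  ⋆Y-cong G≃G′ i u = ∑-cong (colouredSplittings u) (λ {P} _ → P.*-congʳ (G≃G′ i (colours P)))

  ⋆Y-via-splits : ∀ G i u →
    (G ⋆Y) i u ≃ ∑ (λ Cs → ∑ (λ v → G i v *P prodP (zipWith Y v Cs)) (words (length Cs))) (splits u)
  ⋆Y-via-splits G i u = begin
    (G ⋆Y) i u
      ≈⟨ ∑-concatMap _ _ (splits u) ⟩
    ∑ (λ Cs → ∑ (λ P → G i (colours P) *P blockMonomial P) (map (λ v → zip v Cs) (words (length Cs))))
      (splits u)
      ≈⟨ ∑-cong (splits u) (λ {Cs} _ → P.reflexive (∑-map _ (λ v → zip v Cs) (words (length Cs)))) ⟩
    ∑ (λ Cs → ∑ (λ v → G i (colours (zip v Cs)) *P blockMonomial (zip v Cs)) (words (length Cs))) (splits u)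
      ≈⟨ ∑-cong (splits u) (λ {Cs} _ → ∑-cong (words (length Cs)) (λ {v} v∈ →
           P.reflexive (≡.cong₂ (λ w p → G i w *P prodP p)
             (map-proj₁-zip v Cs (sound (words-enumerates (length Cs)) v∈)) (map-uncurry-zip Y v Cs)))) ⟩
    ∑ (λ Cs → ∑ (λ v → G i v *P prodP (zipWith Y v Cs)) (words (length Cs))) (splits u)
      ∎

  ⋆Y-minus : ∀ G G′ i u → ((λ j v → G j v P.- G′ j v) ⋆Y) i u ≃ (G ⋆Y) i u P.- (G′ ⋆Y) i u
  ⋆Y-minus G G′ i u = begin
    ∑ (λ P → (G i (colours P) P.- G′ i (colours P)) *P blockMonomial P) (colouredSplittings u)
      ≈⟨ ∑-cong (colouredSplittings u) (λ {P} _ →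
           [y-z]x≈yx-zx (blockMonomial P) (G i (colours P)) (G′ i (colours P))) ⟩
    ∑ (λ P → term G P P.- term G′ P) (colouredSplittings u)
      ≈⟨ ∑-∙ (term G) (P.-_ ∘ term G′) (colouredSplittings u) ⟩
    (G ⋆Y) i u ++ ∑ (P.-_ ∘ term G′) (colouredSplittings u)
      ≈⟨ P.+-congˡ (scale-∑ (K.- K.1#) (term G′) (colouredSplittings u)) ⟨
    (G ⋆Y) i u P.- (G′ ⋆Y) i u
      ∎
    where
    term : (Color → Word → Poly) → ColouredSplitting → Poly
    term F P = F i (colours P) *P blockMonomial P

  diagonalIndicator : ColouredSplitting → K.Carrier
  diagonalIndicator []            = K.1#
  diagonalIndicator ((j , C) ∷ Q) = δK j C K.* diagonalIndicator Q

  diagonalIndicator-diagonal : ∀ u → diagonalIndicator (diagonal u) K.≈ K.1#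
  diagonalIndicator-diagonal []      = K.refl
  diagonalIndicator-diagonal (a ∷ u) =
    K.trans (K.*-cong (δK-refl a) (diagonalIndicator-diagonal u)) (K.*-identityˡ K.1#)

  diagonalIndicator-≢ : ∀ {u Q} → IsColouredSplitting u Q → Q ≢ diagonal u → diagonalIndicator Q K.≈ K.0#
  diagonalIndicator-≢ {Q = []}            (_ , ≡.refl) Q≢ = ⊥-elim (Q≢ ≡.refl)
  diagonalIndicator-≢ {Q = (j , C) ∷ Q} (_ ∷ ne , eq) Q≢ with C ≟W [ j ]
  ... | no  _ = K.zeroˡ _
  ... | yes ≡.refl with ≡.refl ← eq =
    K.trans (K.*-congˡ (diagonalIndicator-≢ (ne , ≡.refl) (Q≢ ∘ ≡.cong ((j , [ j ]) ∷_)))) (K.zeroʳ _)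

  blockMonomial-singletons : ∀ P → All (λ C → length C ≡ 1) (blocks P) →
                             blockMonomial P ≃ scale (diagonalIndicator P) oneP
  blockMonomial-singletons []                  []           = P.sym (scale-1 oneP)
  blockMonomial-singletons ((j , a ∷ []) ∷ P) (_ ∷ single) = begin
    Y j [ a ] *P blockMonomial P
      ≈⟨ P.*-cong (Y-letter j a) (blockMonomial-singletons P single) ⟩
    scale (δK j [ a ]) oneP *P scale (diagonalIndicator P) oneP
      ≈⟨ scale-*P-scale _ _ oneP oneP ⟩
    scale (diagonalIndicator ((j , [ a ]) ∷ P)) (oneP *P oneP)
      ≈⟨ scale-cong _ (P.*-identityˡ oneP) ⟩
    scale (diagonalIndicator ((j , [ a ]) ∷ P)) oneP
      ∎

  blockMonomial-diagonal : ∀ u → blockMonomial (diagonal u) ≃ oneP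
  blockMonomial-diagonal u = P.trans (blockMonomial-singletons (diagonal u) (singles u))
    (scale-≈1 oneP (diagonalIndicator-diagonal u))
    where
    singles : ∀ v → All (λ C → length C ≡ 1) (blocks (diagonal v))
    singles []      = []
    singles (a ∷ v) = ≡.refl ∷ singles v

  -- Only the diagonal splitting has as many blocks as u has letters; a splitting with
  -- that many blocks but a block not coloured by its letter has a vanishing monomial.
  ⋆Y-single : ∀ G i u → (∀ {P} → IsColouredSplitting u P → length P < length u → G i (colours P) ≃ []) →
              (G ⋆Y) i u ≃ G i u
  ⋆Y-single G i u short⇒0 = begin
    (G ⋆Y) i u
      ≈⟨ ∑-single (unique E) (complete E (diagonal-isColouredSplitting u)) vanish ⟩
    G i (colours (diagonal u)) *P blockMonomial (diagonal u)
      ≈⟨ P.*-cong (P.reflexive (≡.cong (G i) (colours-diagonal u))) (blockMonomial-diagonal u) ⟩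
    G i u *P oneP
      ≈⟨ P.*-identityʳ (G i u) ⟩
    G i u
      ∎
    where
    E : Enumerates (IsColouredSplitting u) (colouredSplittings u)
    E = colouredSplittings-enumerates u
    vanish : ∀ {P} → P ∈ colouredSplittings u → P ≢ diagonal u → G i (colours P) *P blockMonomial P ≃ []
    vanish {P} P∈ P≢ with P-ok ← sound E P∈ | suc (length P) ≤? length u
    ... | yes short  = *P-vanishˡ (blockMonomial P) (short⇒0 P-ok short)
    ... | no  ¬short = *P-vanishʳ (G i (colours P)) monomial≃0
      where
      |u|≤|P| : length (joined P) ≤ length (blocks P)
      |u|≤|P| = ≡.subst₂ _≤_ (≡.cong length (≡.sym (proj₂ P-ok))) (≡.sym (List.length-map proj₂ P))
                          (ℕ.≮⇒≥ ¬short)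
      monomial≃0 : blockMonomial P ≃ []
      monomial≃0 = P.trans (blockMonomial-singletons P (all-singletons (blocks P) (proj₁ P-ok) |u|≤|P|))
        (scale-≈0 oneP (diagonalIndicator-≢ P-ok P≢))

  colours-nonEmpty : ∀ {u P} → NonEmpty u → IsColouredSplitting u P → NonEmpty (colours P)
  colours-nonEmpty {P = []}    () (_ , ≡.refl)
  colours-nonEmpty {P = _ ∷ _} _  _ = tt

  ⋆Y-unique : ∀ G G′ → IsLeftInverseOfY G → IsLeftInverseOfY G′ → ∀ i v → NonEmpty v → G i v ≃ G′ i v
  ⋆Y-unique G G′ G⋆Y≃δ G′⋆Y≃δ i v = bounded (length v) i v ℕ.≤-refl
    where
    D : Color → Word → Poly
    D j w = G j w P.- G′ j w
    bounded : ∀ n i v → length v ≤ n → NonEmpty v → G i v ≃ G′ i v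
    bounded zero    i (_ ∷ _) () _
    bounded (suc n) i v |v|≤ ne = x∙y⁻¹≈ε⇒x≈y (G i v) (G′ i v) (begin
      D i v                        ≈⟨ ⋆Y-single D i v shorter ⟨
      (D ⋆Y) i v                   ≈⟨ ⋆Y-minus G G′ i v ⟩
      (G ⋆Y) i v P.- (G′ ⋆Y) i v   ≈⟨ P.+-cong (G⋆Y≃δ i v ne) (P.-‿cong (G′⋆Y≃δ i v ne)) ⟩
      δ i v P.- δ i v              ≈⟨ P.-‿inverseʳ (δ i v) ⟩
      []                           ∎)
      where
      shorter : ∀ {P} → IsColouredSplitting v P → length P < length v → D i (colours P) ≃ []
      shorter {P} P-ok |P|<|v| = x≈y⇒x∙y⁻¹≈ε {G i (colours P)} {G′ i (colours P)}
        (bounded n i (colours P) |colours|≤n (colours-nonEmpty ne P-ok))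
        where
        |colours|≤n : length (colours P) ≤ n
        |colours|≤n = ≡.subst (_≤ n) (≡.sym (List.length-map proj₁ P)) (ℕ.≤-pred (ℕ.≤-trans |P|<|v| |v|≤))

  reindex : ∀ u (H : ColouredSplitting × ColouredSplitting → Poly) →
            ∑ (λ P → ∑ (λ B → H (P , B)) (properColouredSplittings (colours P))) (colouredSplittings u) ≃
            ∑ (λ Q → ∑ (λ Ps → H (merge (Q , Ps))) (blockSplittings Q)) (properColouredSplittings u)
  reindex u H = begin
    ∑ (λ P → ∑ (λ B → H (P , B)) (properColouredSplittings (colours P))) (colouredSplittings u)
      ≈⟨ ∑-pairs H (colouredSplittings u) _ ⟨
    ∑ H (pairs (colouredSplittings u) (properColouredSplittings ∘ colours))
      ≈⟨ ∑-↭ H (Enumerates⇒↭ (coarsenings-enumerates u) (merges-enumerates u)) ⟩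
    ∑ H (map merge (pairs (properColouredSplittings u) blockSplittings))
      ≡⟨ ∑-map H merge (pairs (properColouredSplittings u) blockSplittings) ⟩
    ∑ (H ∘ merge) (pairs (properColouredSplittings u) blockSplittings)
      ≈⟨ ∑-pairs (H ∘ merge) (properColouredSplittings u) blockSplittings ⟩
    ∑ (λ Q → ∑ (λ Ps → H (merge (Q , Ps))) (blockSplittings Q)) (properColouredSplittings u)
      ∎

  blockMonomial-concat : ∀ Ps → blockMonomial (concat Ps) ≃ prodP (map blockMonomial Ps)
  blockMonomial-concat []       = P.refl
  blockMonomial-concat (P ∷ Ps) = begin
    prodP (map (uncurry Y) (P ++ concat Ps))
      ≡⟨ ≡.cong prodP (List.map-++ (uncurry Y) P (concat Ps)) ⟩
    prodP (map (uncurry Y) P ++ map (uncurry Y) (concat Ps))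
      ≈⟨ prodP-++ (map (uncurry Y) P) _ ⟩
    blockMonomial P *P blockMonomial (concat Ps)
      ≈⟨ *P-congˡ (blockMonomial P) (blockMonomial-concat Ps) ⟩
    blockMonomial P *P prodP (map blockMonomial Ps)
      ∎

  refinedTerm : (Color → Word → Poly) → ColouredSplitting → List ColouredSplitting → Poly
  refinedTerm G Q Ps = ∏ʳ (zipWith G (colours Q) (map colours Ps)) *P prodP (map blockMonomial Ps)

  branchTerm : (Color → Word → Poly) → Color → ColouredSplitting × ColouredSplitting → Poly
  branchTerm G i (P , B) = (Y i (colours B) *P ∏ʳ (map (uncurry G) B)) *P blockMonomial P

  branchTerm-merge : ∀ G i {Q Ps} → Pointwise Refines Q Ps →
                     branchTerm G i (merge (Q , Ps)) ≃ Y i (colours Q) *P refinedTerm G Q Ps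
  branchTerm-merge G i {Q} {Ps} pw = begin
    (Y i (colours coarse) *P ∏ʳ (map (uncurry G) coarse)) *P blockMonomial (concat Ps)
      ≡⟨ ≡.cong₂ (λ cs gs → (Y i cs *P ∏ʳ gs) *P blockMonomial (concat Ps))
                 (map-proj₁-zip (colours Q) (map colours Ps) (refines-length pw))
                 (map-uncurry-zip G (colours Q) (map colours Ps)) ⟩
    (Y i (colours Q) *P rest) *P blockMonomial (concat Ps)
      ≈⟨ P.*-assoc (Y i (colours Q)) rest _ ⟩
    Y i (colours Q) *P (rest *P blockMonomial (concat Ps))
      ≈⟨ *P-congˡ (Y i (colours Q)) (*P-congˡ rest (blockMonomial-concat Ps)) ⟩
    Y i (colours Q) *P refinedTerm G Q Ps
      ∎
    where
    rest : Poly
    rest = ∏ʳ (zipWith G (colours Q) (map colours Ps))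
    coarse : ColouredSplitting
    coarse = proj₂ (merge (Q , Ps))

  -- The reversed product in refinedTerm puts the factor of the first block next to its
  -- monomial, so summing over the splittings of that block produces (G ⋆Y) j C = δ j C,
  -- a scalar, which then commutes out of the remaining product.
  ∑-refinedTerm : ∀ G Q → (∀ {j C} → (j , C) ∈ Q → (G ⋆Y) j C ≃ δ j C) →
                  ∑ (refinedTerm G Q) (blockSplittings Q) ≃ scale (diagonalIndicator Q) oneP
  ∑-refinedTerm G []            _        =
    P.trans (P.+-identityʳ _) (P.trans (P.*-identityˡ oneP) (P.sym (scale-1 oneP)))
  ∑-refinedTerm G ((j , C) ∷ Q) G⋆Y≃δ = begin
    ∑ (refinedTerm G ((j , C) ∷ Q)) (map (uncurry _∷_) (pairs first λ _ → others))
      ≡⟨ ∑-map _ (uncurry _∷_) (pairs first λ _ → others) ⟩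
    ∑ (λ (P₁ , Ps) → refinedTerm G ((j , C) ∷ Q) (P₁ ∷ Ps)) (pairs first λ _ → others)
      ≈⟨ ∑-pairs _ first (λ _ → others) ⟩
    ∑ (λ P₁ → ∑ (λ Ps → refinedTerm G ((j , C) ∷ Q) (P₁ ∷ Ps)) others) first
      ≈⟨ ∑-cong first (λ {P₁} _ → ∑-cong others (λ {Ps} _ → reassociate P₁ Ps)) ⟩
    ∑ (λ P₁ → ∑ (term P₁) others) first
      ≈⟨ ∑-swap term first others ⟩
    ∑ (λ Ps → ∑ (λ P₁ → term P₁ Ps) first) others
      ≈⟨ ∑-cong others (λ {Ps} _ → ∑-sandwich (rest Ps) (monomials Ps) _ first) ⟩
    ∑ (λ Ps → rest Ps *P ((G ⋆Y) j C *P monomials Ps)) others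
      ≈⟨ ∑-cong others (λ {Ps} _ → scalar-out Ps) ⟩
    ∑ (λ Ps → scale k (refinedTerm G Q Ps)) others
      ≈⟨ scale-∑ k (refinedTerm G Q) others ⟨
    scale k (∑ (refinedTerm G Q) others)
      ≈⟨ scale-cong k (∑-refinedTerm G Q (G⋆Y≃δ ∘ there)) ⟩
    scale k (scale (diagonalIndicator Q) oneP)
      ≈⟨ scale-scale k (diagonalIndicator Q) oneP ⟩
    scale (diagonalIndicator ((j , C) ∷ Q)) oneP
      ∎
    where
    first : List ColouredSplitting
    first = colouredSplittings C
    others : List (List ColouredSplitting)
    others = blockSplittings Q
    k : K.Carrier
    k = δK j C
    g : ColouredSplitting → Poly
    g P₁ = G j (colours P₁)
    rest : List ColouredSplitting → Poly
    rest Ps = ∏ʳ (zipWith G (colours Q) (map colours Ps))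
    monomials : List ColouredSplitting → Poly
    monomials Ps = prodP (map blockMonomial Ps)
    term : ColouredSplitting → List ColouredSplitting → Poly
    term P₁ Ps = rest Ps *P ((g P₁ *P blockMonomial P₁) *P monomials Ps)
    reassociate : ∀ P₁ Ps → refinedTerm G ((j , C) ∷ Q) (P₁ ∷ Ps) ≃ term P₁ Ps
    reassociate P₁ Ps = P.trans (P.*-assoc (rest Ps) (g P₁) _)
      (*P-congˡ (rest Ps) (P.sym (P.*-assoc (g P₁) (blockMonomial P₁) (monomials Ps))))
    scalar-out : ∀ Ps → rest Ps *P ((G ⋆Y) j C *P monomials Ps) ≃ scale k (refinedTerm G Q Ps)
    scalar-out Ps = P.trans (*P-congˡ (rest Ps) (*P-congʳ (monomials Ps) (G⋆Y≃δ (here ≡.refl))))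
                            (scale-oneP-central k (rest Ps) (monomials Ps))

  properDiagonalSum : Color → Word → Poly
  properDiagonalSum i u =
    ∑ (λ Q → Y i (colours Q) *P scale (diagonalIndicator Q) oneP) (properColouredSplittings u)

  branchSum-⋆Y : ∀ G i u →
                 (∀ {Q j C} → Q ∈ properColouredSplittings u → (j , C) ∈ Q → (G ⋆Y) j C ≃ δ j C) →
                 (branchSum G ⋆Y) i u ≃
                 properDiagonalSum i u
  branchSum-⋆Y G i u G⋆Y≃δ = begin
    ∑ (λ P → branchSum G i (colours P) *P blockMonomial P) (colouredSplittings u)
      ≈⟨ ∑-cong (colouredSplittings u) (λ {P} _ →
           ∑-distribʳ (blockMonomial P) _ (properColouredSplittings (colours P))) ⟩
    ∑ (λ P → ∑ (λ B → branchTerm G i (P , B)) (properColouredSplittings (colours P))) (colouredSplittings u)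
      ≈⟨ reindex u (branchTerm G i) ⟩
    ∑ (λ Q → ∑ (λ Ps → branchTerm G i (merge (Q , Ps))) (blockSplittings Q)) proper
      ≈⟨ ∑-cong proper (λ {Q} _ → ∑-cong (blockSplittings Q) λ Ps∈ →
           branchTerm-merge G i (sound (blockSplittings-enumerates Q) Ps∈)) ⟩
    ∑ (λ Q → ∑ (λ Ps → Y i (colours Q) *P refinedTerm G Q Ps) (blockSplittings Q)) proper
      ≈⟨ ∑-cong proper (λ {Q} _ → P.sym (∑-distribˡ (Y i (colours Q)) _ (blockSplittings Q))) ⟩
    ∑ (λ Q → Y i (colours Q) *P ∑ (refinedTerm G Q) (blockSplittings Q)) proper
      ≈⟨ ∑-cong proper (λ {Q} Q∈ → *P-congˡ (Y i (colours Q)) (∑-refinedTerm G Q (G⋆Y≃δ Q∈))) ⟩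
    properDiagonalSum i u
      ∎
    where
    proper : List ColouredSplitting
    proper = properColouredSplittings u

  properDiagonalSum≃Y : ∀ i u → 2 ≤ length u → properDiagonalSum i u ≃ Y i u
  properDiagonalSum≃Y i u 2≤|u| = begin
    properDiagonalSum i u
      ≈⟨ ∑-single (unique E) (complete E diagonal-proper) vanish ⟩
    Y i (colours (diagonal u)) *P scale (diagonalIndicator (diagonal u)) oneP
      ≈⟨ P.*-cong (P.reflexive (≡.cong (Y i) (colours-diagonal u)))
                  (scale-≈1 oneP (diagonalIndicator-diagonal u)) ⟩
    Y i u *P oneP
      ≈⟨ P.*-identityʳ (Y i u) ⟩
    Y i u
      ∎
    where
    E : Enumerates (IsProperColouredSplitting u) (properColouredSplittings u)
    E = properColouredSplittings-enumerates u
    diagonal-proper : IsProperColouredSplitting u (diagonal u)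
    diagonal-proper = diagonal-isColouredSplitting u , ≡.subst (2 ≤_) (≡.sym (List.length-map _ u)) 2≤|u|
    vanish : ∀ {Q} → Q ∈ properColouredSplittings u → Q ≢ diagonal u →
             Y i (colours Q) *P scale (diagonalIndicator Q) oneP ≃ []
    vanish {Q} Q∈ Q≢ =
      *P-vanishʳ (Y i (colours Q)) (scale-≈0 oneP (diagonalIndicator-≢ (proj₁ (sound E Q∈)) Q≢))

  properDiagonalSum-letter : ∀ i a → properDiagonalSum i [ a ] ≃ []
  properDiagonalSum-letter i a = ∑-ε (properColouredSplittings [ a ]) λ Q∈ →
    ⊥-elim (ℕ.1+n≰n (proper⇒2≤length (sound (properColouredSplittings-enumerates [ a ]) Q∈)))

  single-block : ∀ {u P i} → IsColouredSplitting u P → colours P ≡ [ i ] → P ≡ [ (i , u) ]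
  single-block {P = (_ , C) ∷ []} (_ , C++[]≡u) ≡.refl =
    ≡.cong (λ w → [ (_ , w) ]) (≡.trans (≡.sym (List.++-identityʳ C)) C++[]≡u)

  δ-⋆Y : ∀ i u → NonEmpty u → (δ ⋆Y) i u ≃ Y i u
  δ-⋆Y i u ne = begin
    (δ ⋆Y) i u
      ≈⟨ ∑-single (unique E) (complete E ((ne ∷ []) , List.++-identityʳ u)) vanish ⟩
    δ i [ i ] *P (Y i u *P oneP)
      ≈⟨ P.*-cong (scale-≈1 oneP (δK-refl i)) (P.*-identityʳ (Y i u)) ⟩
    oneP *P Y i u
      ≈⟨ P.*-identityˡ (Y i u) ⟩
    Y i u
      ∎
    where
    E : Enumerates (IsColouredSplitting u) (colouredSplittings u)
    E = colouredSplittings-enumerates u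
    vanish : ∀ {P} → P ∈ colouredSplittings u → P ≢ [ (i , u) ] → δ i (colours P) *P blockMonomial P ≃ []
    vanish {P} P∈ P≢ = *P-vanishˡ (blockMonomial P) (scale-≈0 oneP (δK-≢ (P≢ ∘ single-block (sound E P∈))))

  Y-properDiagonalSum : ∀ i u → NonEmpty u → Y i u P.- properDiagonalSum i u ≃ δ i u
  Y-properDiagonalSum i (a ∷ []) _ = begin
    Y i [ a ] P.- properDiagonalSum i [ a ]  ≈⟨ P.+-congˡ (P.-‿cong (properDiagonalSum-letter i a)) ⟩
    Y i [ a ] P.- []                         ≈⟨ P.+-identityʳ (Y i [ a ]) ⟩
    Y i [ a ]                                ≈⟨ Y-letter i a ⟩
    δ i [ a ]                                ∎
  Y-properDiagonalSum i u@(_ ∷ _ ∷ _) _ = begin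
    Y i u P.- properDiagonalSum i u  ≈⟨ P.+-congˡ (P.-‿cong (properDiagonalSum≃Y i u (s≤s (s≤s z≤n)))) ⟩
    Y i u P.- Y i u                  ≈⟨ P.-‿inverseʳ (Y i u) ⟩
    []                               ≈⟨ scale-≈0 oneP (δK-≢ {i} {u} λ ()) ⟨
    δ i u                            ∎

  treeSum-⋆Y : IsLeftInverseOfY treeSum
  treeSum-⋆Y i u = bounded (length u) i u ℕ.≤-refl
    where
    bounded : ∀ n i u → length u ≤ n → NonEmpty u → (treeSum ⋆Y) i u ≃ δ i u
    bounded zero    i (_ ∷ _) () _
    bounded (suc n) i u |u|≤ ne = begin
      (treeSum ⋆Y) i u
        ≈⟨ ⋆Y-cong treeSum-rec i u ⟩
      ((λ j v → δ j v P.- branchSum treeSum j v) ⋆Y) i u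
        ≈⟨ ⋆Y-minus δ (branchSum treeSum) i u ⟩
      (δ ⋆Y) i u P.- (branchSum treeSum ⋆Y) i u
        ≈⟨ P.+-cong (δ-⋆Y i u ne) (P.-‿cong (branchSum-⋆Y treeSum i u blocks-⋆Y)) ⟩
      Y i u P.- properDiagonalSum i u
        ≈⟨ Y-properDiagonalSum i u ne ⟩
      δ i u
        ∎
      where
      blocks-⋆Y : ∀ {Q j C} → Q ∈ properColouredSplittings u → (j , C) ∈ Q → (treeSum ⋆Y) j C ≃ δ j C
      blocks-⋆Y Q∈ jC∈ with Q-ok@((ne-blocks , _) , _) ← sound (properColouredSplittings-enumerates u) Q∈ =
        bounded n _ _ (ℕ.≤-pred (ℕ.≤-trans (length-<-proper Q-ok jC∈) |u|≤))
                      (All.lookup ne-blocks (∈.∈-map⁺ proj₂ jC∈))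

module Antipode {c ℓ} (R : CommutativeRing c ℓ) (N : ℕ) (S : Lagrange.Mon R N → Lagrange.Poly R N) where
  open Lagrange R N
  private module K = CommutativeRing R
  open FreeAlgebra R N
  open ColouredSplittings R N
  open TreeSums R N
  open Convolution R N
  open ≃-Reasoning

  S∘Y : Color → Word → Poly
  S∘Y i v = linExt S (Y i v)

  antipodeSum-generator : ∀ i a b w →
    sumP (map (λ (p , q) → linExt S q *P p) (Δ (Y i (a ∷ b ∷ w)))) ≃ (S∘Y ⋆Y) i (a ∷ b ∷ w)
  antipodeSum-generator i a b w = begin
    ∑ G′ (terms ++ [])
      ≡⟨ ≡.cong (∑ G′) (List.++-identityʳ terms) ⟩
    ∑ G′ terms
      ≡⟨ ∑-map G′ _ (concatMap (λ (p , q) → [ (p *P oneP , q *P oneP) ]) D) ⟩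
    ∑ (λ (p , q) → linExt S q *P scale K.1# p) (concatMap (λ (p , q) → [ (p *P oneP , q *P oneP) ]) D)
      ≈⟨ ∑-concatMap _ _ D ⟩
    ∑ (λ (p , q) → linExt S (q *P oneP) *P scale K.1# (p *P oneP) ++ []) D
      ≈⟨ ∑-cong D (λ {(p , q)} _ → P.trans (P.+-identityʳ _)
           (P.*-cong (linExt-cong S (P.*-identityʳ q)) (P.trans (scale-1 _) (P.*-identityʳ p)))) ⟩
    ∑ G′ D
      ≈⟨ ∑-concatMap G′ _ (splits u) ⟩
    ∑ (λ Cs → ∑ G′ (map (λ v → prodP (zipWith Y v Cs) , Y i v) (words (length Cs)))) (splits u)
      ≈⟨ ∑-cong (splits u) (λ {Cs} _ → P.reflexive (∑-map G′ _ (words (length Cs)))) ⟩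
    ∑ (λ Cs → ∑ (λ v → S∘Y i v *P prodP (zipWith Y v Cs)) (words (length Cs))) (splits u)
      ≈⟨ ⋆Y-via-splits S∘Y i u ⟨
    (S∘Y ⋆Y) i u
      ∎
    where
    u : Word
    u = a ∷ b ∷ w
    D : Tensor
    D = ΔGen (i , a , b , w)
    terms : List (Poly × Poly)
    terms = map (λ (p , q) → scale K.1# p , q) (concatMap (λ (p , q) → [ (p *P oneP , q *P oneP) ]) D)
    G′ : Poly × Poly → Poly
    G′ (p , q) = linExt S q *P p

  S-one : IsAntipodeL S → linExt S oneP ≃ oneP
  S-one S-antipode = begin
    linExt S oneP                              ≈⟨ P.*-identityʳ (linExt S oneP) ⟨
    linExt S oneP *P oneP                      ≈⟨ *P-congˡ (linExt S oneP) (scale-1 oneP) ⟨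
    linExt S oneP *P scale K.1# oneP           ≈⟨ P.+-identityʳ _ ⟨
    (linExt S oneP *P scale K.1# oneP) ++ []   ≈⟨ ≈P⇒≃ (proj₁ (S-antipode oneP)) ⟩
    scale (K.1# K.+ K.0#) oneP                 ≈⟨ scale-≈1 oneP (K.+-identityʳ K.1#) ⟩
    oneP                                       ∎

  S∘Y-⋆Y : IsAntipodeL S → IsLeftInverseOfY S∘Y
  S∘Y-⋆Y S-antipode i (a ∷ []) _ = begin
    (S∘Y ⋆Y) i [ a ]                  ≈⟨ ⋆Y-single S∘Y i [ a ] no-shorter ⟩
    linExt S (Y i [ a ])              ≈⟨ linExt-cong S (Y-letter i a) ⟩
    linExt S (δ i [ a ])              ≈⟨ linExt-scale S (δK i [ a ]) oneP ⟩
    scale (δK i [ a ]) (linExt S oneP) ≈⟨ scale-cong (δK i [ a ]) (S-one S-antipode) ⟩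
    δ i [ a ]                         ∎
    where
    no-shorter : ∀ {P} → IsColouredSplitting [ a ] P → length P < 1 → S∘Y i (colours P) ≃ []
    no-shorter {[]}    (_ , ()) _
    no-shorter {_ ∷ _} _        (s≤s ())
  S∘Y-⋆Y S-antipode i u@(a ∷ b ∷ w) _ = begin
    (S∘Y ⋆Y) i u                                          ≈⟨ antipodeSum-generator i a b w ⟨
    sumP (map (λ (p , q) → linExt S q *P p) (Δ (Y i u)))   ≈⟨ ≈P⇒≃ (proj₁ (S-antipode (Y i u))) ⟩
    scale K.0# oneP                                       ≈⟨ scale-congˡ oneP (δK-≢ {i} {u} λ ()) ⟨
    δ i u                                                 ∎

theorem8 : ∀ {c ℓ} (R : CommutativeRing c ℓ) (N : ℕ) → 1 ≤ N →
    let open Lagrange R N in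
    (S : Mon → Poly) → IsAntipodeL S →
    (i : Color) (u : Word) → 2 ≤ length u →
    (Ts : List Tree) → Unique Ts → (∀ T → (T ∈ Ts) ⇔ InRT i u T) →
    linExt S (Y i u) ≈P sumP (map (λ T → scale (sign (vT T)) (ΛL T)) Ts)
theorem8 R N _ S _          i (_ ∷ [])       (s≤s ()) _ _ _
theorem8 R N _ S S-antipode i u@(_ ∷ _ ∷ _) _ Ts Ts-unique Ts⇔RT = ≃⇒≈P (begin
    linExt S (Y i u)  ≈⟨ ⋆Y-unique S∘Y treeSum (S∘Y-⋆Y S-antipode) treeSum-⋆Y i u tt ⟩
    treeSum i u       ≈⟨ treeSum-enumeration Ts-enumerates ⟨
    ∑ weight Ts       ∎)
  where
  open Lagrange R N
  open FreeAlgebra R N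
  open TreeSums R N
  open Convolution R N
  open Antipode R N S
  open ≃-Reasoning
  Ts-enumerates : Enumeration.Enumerates (InRT i u) Ts
  Ts-enumerates = record
    { unique = Ts-unique ; sound = Equivalence.to (Ts⇔RT _) ; complete = Equivalence.from (Ts⇔RT _) }
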